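{- Let $w$ be a finite OP word, $T_w=\tau(w)$, and $\varphi,\psi$ formulas of $\mathcal{X}_{until}$ such that for every position $i'$ of $w$, $(T_w,\tau(i'))\models\varphi$ iff $(w,i')\models\iota(\varphi)$, and $(T_w,\tau(i'))\models\psi$ iff $(w,i')\models\iota(\psi)$. Then for every position $i$ of $w$, $(T_w,\tau(i))\models\Rightarrow(\varphi,\psi)$ iff $(w,i)\models\iota(\Rightarrow(\varphi,\psi))$, where, with $\varphi'=\iota(\varphi)$ and $\psi'=\iota(\psi)$, $\iota(\Rightarrow(\varphi,\psi))=\bigcirc^u_H(\varphi'\,\mathcal{U}^u_H\,\psi')\lor\big(\neg\bigcirc^u_H(\top\,\mathcal{U}^u_H\,\neg\varphi')\land\ominus^{\lessdot}_\chi(\bigcirc^{\doteq}_\chi\psi')\big)\lor\ominus^{\lessdot}\big(\bigcirc^{\lessdot}_\chi(\psi'\land\neg\ominus^u_H(\top\,\mathcal{S}^u_H\,\neg\varphi'))\big)\lor\ominus^{\lessdot}\big(\bigcirc^{\doteq}_\chi\psi'\land\neg\bigcirc^{\lessdot}_\chi\neg\varphi'\big)$.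
   Context: OP words: $AP$ finite set of atomic propositions, $\Sigma=2^{AP}$, $\#\notin\Sigma$ a delimiter. An OPM $M$ is a partial function $(\Sigma\cup\{\#\})^2\to\{\lessdot,\doteq,\gtrdot\}$, writing $a\mathrel{\pi}b$ when $M(a,b)=\pi$; by convention $\#\lessdot a$, $a\gtrdot\#$. A simple chain is $c_0c_1\dots c_\ell c_{\ell+1}$ ($\ell\ge1$), $c_0,c_{\ell+1}\in\Sigma\cup\{\#\}$, $c_1..c_\ell\in\Sigma$, $c_0\lessdot c_1\doteq\dots\doteq c_\ell\gtrdot c_{\ell+1}$; a composed chain is $c_0s_0c_1\dots c_\ell s_\ell c_{\ell+1}$ with $c_0\dots c_{\ell+1}$ simple and each $s_k$ empty or $c_ks_kc_{k+1}$ a chain; $c_0,c_{\ell+1}$ are left/right contexts. $w\in\Sigma^*$ is compatible with $M$ if $M$ is defined on consecutive letter pairs and on contexts of every chain that is a substring of $\#w\#$. A finite OP word is such $w=w_1\dots w_n$ on positions $\{0,\dots,n+1\}$ with $\#$ at $0,n+1$ (atomic proposition $\#$ true exactly there) and label $w_k$ at $k$; $i\mathrel{\pi}j$ compares labels; $\chi(i,j)$ iff $i<j-1$ and $i,j$ are left and right contexts of the same chain occurring in $\#w\#$. Trees: an unranked ordered tree (UOT) has node set $S$ of finite sequences of naturals, prefix-closed, with $s\cdot k\in S$, $k>0$ implying $s\cdot(k-1)\in S$; child relation $s R_\Downarrow s\cdot k$; next-sibling relation $r\cdot h\,R_\Rightarrow\,r\cdot(h+1)$; $R_\Uparrow,R_\Leftarrow$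 are their inverses; nodes labeled by sets of atomic propositions; $R^+_\rho$ is the transitive closure. $\tau(w)$: position $0$ is the root; for each position $i$: if $i\doteq i+1$, $\tau(i+1)$ is the only child of $\tau(i)$; if $i\gtrdot i+1$, $\tau(i)$ is a leaf; if $i\lessdot i+1$, the children of $\tau(i)$ in order are $\tau(i+1),\tau(j_1),\dots,\tau(j_m)$ where $j_1<\dots<j_m$ are all positions with $\chi(i,j_k)$ and ($i\lessdot j_k$ or $i\doteq j_k$). Node $\tau(i)$ gets the label of $i$. $\mathcal{X}_{until}$: $\varphi::=\mathrm{a}\mid\top\mid\neg\varphi\mid\varphi\land\varphi\mid\rho(\varphi,\varphi)$, $\rho\in\{\Downarrow,\Uparrow,\Rightarrow,\Leftarrow\}$; $(T,s)\models\rho(\varphi,\psi)$ iff there is $t$ with $sR^+_\rho t$, $(T,t)\models\psi$, and every $r$ with $sR^+_\rho r$ and $rR^+_\rho t$ satisfies $\varphi$. POTL semantics at position $i$ (operators needed): $\bigcirc^d\theta$: $i+1$ exists, ($i\lessdot i+1$ or $i\doteq i+1$), $\theta$ at $i+1$; $\ominus^d\theta$: $i\ge1$, ($i-1\lessdot i$ or $i-1\doteq i$), $\theta$ at $i-1$. $\bigcirc^d_\chi\theta$: some $j>i$, $\chi(i,j)$, ($i\lessdot j$ or $i\doteq j$), $\theta$ at $j$; $\ominus^d_\chi\theta$: some $j<i$, $\chi(j,i)$, ($j\lessdot i$ or $j\doteq i$), $\theta$ at $j$. DSP between $i\le j$: $i=i_1<\dots<i_n=j$ with $i_{p+1}=\max\{h\le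 j\mid\chi(i_p,h),\ i_p\lessdot h\text{ or }i_p\doteq h\}$ if nonempty, else $i_{p+1}=i_p+1$ with $i_p\lessdot i_p+1$ or $i_p\doteq i_p+1$. $\theta_1\,\mathcal{U}^d_\chi\,\theta_2$ at $i$: some $j\ge i$, DSP between $i$ and $j$, $\theta_2$ at $j$, $\theta_1$ at other path positions; $\theta_1\,\mathcal{S}^d_\chi\,\theta_2$: some $j\le i$, DSP between $j$ and $i$, $\theta_2$ at $j$, $\theta_1$ elsewhere. $\bigcirc^u_H\theta$: some $h<i$ with $\chi(h,i)$, $h\lessdot i$, and $j=\min\{k>i\mid\chi(h,k),h\lessdot k\}$ exists with $\theta$ at $j$; $\ominus^u_H\theta$: same with $j=\max\{k<i\mid\chi(h,k),h\lessdot k\}$. UHP between $i\le j$: $i=i_1<\dots<i_n=j$ with some $h<i$ s.t. $\chi(h,i_p)$, $h\lessdot i_p$ for all $p$, and no $k$ with $i_q<k<i_{q+1}$, $\chi(h,k)$. $\theta_1\,\mathcal{U}^u_H\,\theta_2$ at $i$: some $j\ge i$ and UHP between $i$ and $j$, $\theta_2$ at $j$, $\theta_1$ elsewhere; $\theta_1\,\mathcal{S}^u_H\,\theta_2$: some $j\le i$ and UHP between $j$ and $i$, $\theta_2$ at $j$, $\theta_1$ elsewhere. Restricted operators (POTL-definable as disjunctions over pairs of labels): $\bigcirc^{\pi}_\chi\theta$ ($\pi\in\{\lessdot,\doteq\}$): some $j$ with $\chi(i,j)$, $i\mathrel{\pi}j$, $\theta$ at $j$; $\ominus^{\pi}_\chi\theta$: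 some $j<i$ with $\chi(j,i)$, $j\mathrel{\pi}i$, $\theta$ at $j$; $\bigcirc^{\lessdot}\theta$: $i\lessdot i+1$, $\theta$ at $i+1$; $\ominus^{\lessdot}\theta$: $i-1\lessdot i$, $\theta$ at $i-1$. Translation $\iota$ from $\mathcal{X}_{until}$ to POTL, recursively, with $\varphi'=\iota(\varphi)$, $\psi'=\iota(\psi)$: identity on atomic propositions, $\top$, $\neg$, $\land$; $\iota(\Downarrow(\varphi,\psi))=\bigcirc^d(\varphi'\mathcal{U}^d_\chi\psi')\lor\bigcirc^d_\chi(\varphi'\mathcal{U}^d_\chi\psi')$; $\iota(\Uparrow(\varphi,\psi))=\ominus^d(\varphi'\mathcal{S}^d_\chi\psi')\lor\ominus^d_\chi(\varphi'\mathcal{S}^d_\chi\psi')$; $\iota(\Rightarrow(\varphi,\psi))$ as in the claim; $\iota(\Leftarrow(\varphi,\psi))=\ominus^u_H(\varphi'\mathcal{S}^u_H\psi')\lor\ominus^{\doteq}_\chi(\bigcirc^{\lessdot}_\chi(\neg\bigcirc^u_H\top\land\varphi'\mathcal{S}^u_H\psi'))\lor(\ominus^{\lessdot}_\chi(\bigcirc^{\lessdot}\psi')\land\neg\ominus^u_H(\top\,\mathcal{S}^u_H\neg\varphi'))\lor\ominus^{\doteq}_\chi(\bigcirc^{\lessdot}\psi'\land\neg\bigcirc^{\lessdot}_\chi\neg\varphi')$. -}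

module Defs where

open import Data.Nat using (ℕ; zero; suc; _<_; _≤_)
open import Data.Fin using (Fin)
open import Data.Fin.Subset using (Subset) renaming (_∈_ to _∈ₛ_)
open import Data.Vec using (Vec; toList)
open import Data.List using (List; []; _∷_; _++_; [_]; map; length)
open import Data.List.Membership.Propositional using (_∈_)
open import Data.List.Relation.Unary.Unique.Propositional using (Unique)
open import Data.Maybe using (Maybe; just; nothing; _>>=_)
open import Data.Product using (Σ; ∃; ∃₂; _×_; _,_)
open import Data.Sum using (_⊎_)
open import Data.Unit using (⊤)
open import Data.Empty using (⊥)
open import Relation.Nullary using (¬_)
open import Relation.Binary.PropositionalEquality using (_≡_)
open import Relation.Binary.Construct.Closure.Transitive using (TransClosure)
open import Function.Bundles using (_⇔_)

-- Atomic propositions AP = Fin k (a finite set), Σ = 2^AP = Subset k.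
-- Symbols: letters of Σ, or the delimiter #.

data Sym (k : ℕ) : Set where
  #   : Sym k
  ⟨_⟩ : Subset k → Sym k

data Prec : Set where
  ⋖ ≐ ⋗ : Prec

record OPM (k : ℕ) : Set where
  field
    M       : Sym k → Sym k → Maybe Prec
    hashL   : ∀ a → M # ⟨ a ⟩ ≡ just ⋖
    hashR   : ∀ a → M ⟨ a ⟩ # ≡ just ⋗

data Dir : Set where
  ⇓ ⇑ ⇒ ⇐ : Dir

at : ∀ {A : Set} → List A → ℕ → Maybe A
at []       _       = nothing
at (x ∷ xs) zero    = just x
at (x ∷ xs) (suc p) = at xs p

-- Finite OP word: w = w_1 … w_n, positions 0 … n+1 of #w#.

module _ {k : ℕ} (𝕄 : OPM k) {n : ℕ} (w : Vec (Subset k) n) where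
  open OPM 𝕄

  hw : List (Sym k)
  hw = # ∷ (map ⟨_⟩ (toList w) ++ [ # ])

  symAt : ℕ → Maybe (Sym k)
  symAt = at hw

  cmp : ℕ → ℕ → Maybe Prec
  cmp i j = symAt i >>= λ a → symAt j >>= λ b → M a b

  PR : ℕ → Prec → ℕ → Set
  PR i π j = cmp i j ≡ just π

  Holds : Fin k → ℕ → Set
  Holds a i = ∃ λ σ → (symAt i ≡ just ⟨ σ ⟩) × (a ∈ₛ σ)

  -- Chains occurring in #w#, with left context at position i and right
  -- context at position j.  A chain is c₀ s₀ c₁ … c_ℓ s_ℓ c_{ℓ+1} where
  -- c₀ ⋖ c₁ ≐ … ≐ c_ℓ ⋗ c_{ℓ+1} and each gap s_h is empty (Gap adj)
  -- or c_h s_h c_{h+1} is itself a chain (Gap sub).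
  mutual
    data Chain : ℕ → ℕ → Set where
      chain : ∀ {i a b j} → PR i ⋖ a → Gap i a → EqSeq a b → PR b ⋗ j → Gap b j → Chain i j

    data EqSeq : ℕ → ℕ → Set where
      one  : ∀ {a} → EqSeq a a
      step : ∀ {a b c} → PR a ≐ b → Gap a b → EqSeq b c → EqSeq a c

    data Gap : ℕ → ℕ → Set where
      adj : ∀ {p} → Gap p (suc p)
      sub : ∀ {p q} → Chain p q → Gap p q

  χ : ℕ → ℕ → Set
  χ i j = (suc i < j) × Chain i j

  record Compatible : Set where
    field
      consec : ∀ p → 1 ≤ p → suc p ≤ n → ∃ λ π → PR p π (suc p)
      ctx    : ∀ i j → Chain i j → ∃ λ π → PR i π j

  -- The tree τ(w), as the relation  Tau i s  :  τ(i) = s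
  -- (nodes are finite sequences of naturals, s·k = s ++ [ k ]).

  LtEq : ℕ → ℕ → Set
  LtEq i j = PR i ⋖ j ⊎ PR i ≐ j

  ChildCond : ℕ → ℕ → Set
  ChildCond i j = χ i j × LtEq i j

  CountBelow : ℕ → ℕ → ℕ → Set
  CountBelow i j c = ∃ λ (L : List ℕ) →
    Unique L × (∀ x → (x ∈ L) ⇔ ((x < j) × ChildCond i x)) × (length L ≡ c)

  data Tau : ℕ → List ℕ → Set where
    root    : Tau 0 []
    eqChild : ∀ {i s} → Tau i s → PR i ≐ (suc i) → Tau (suc i) (s ++ [ 0 ])
    ltFirst : ∀ {i s} → Tau i s → PR i ⋖ (suc i) → Tau (suc i) (s ++ [ 0 ])
    ltChi   : ∀ {i s j c} → Tau i s → PR i ⋖ (suc i) → ChildCond i j →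
              CountBelow i j c → Tau j (s ++ [ suc c ])

  Node : List ℕ → Set
  Node s = ∃ λ i → Tau i s

  NHolds : Fin k → List ℕ → Set
  NHolds a s = ∃ λ i → Tau i s × Holds a i

  Rdown : List ℕ → List ℕ → Set
  Rdown s t = Node s × Node t × ∃ λ h → t ≡ s ++ [ h ]

  Rright : List ℕ → List ℕ → Set
  Rright s t = Node s × Node t × ∃₂ λ r h → (s ≡ r ++ [ h ]) × (t ≡ r ++ [ suc h ])

  R : Dir → List ℕ → List ℕ → Set
  R ⇓ s t = Rdown s t
  R ⇑ s t = Rdown t s
  R ⇒ s t = Rright s t
  R ⇐ s t = Rright t s

  R⁺ : Dir → List ℕ → List ℕ → Set
  R⁺ ρ = TransClosure (R ρ)

data XF (k : ℕ) : Set where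
  atom  : Fin k → XF k
  ttrue : XF k
  neg   : XF k → XF k
  conj  : XF k → XF k → XF k
  until : Dir → XF k → XF k → XF k

module _ {k : ℕ} (𝕄 : OPM k) {n : ℕ} (w : Vec (Subset k) n) where
  XSat : List ℕ → XF k → Set
  XSat s (atom a)        = NHolds 𝕄 w a s
  XSat s ttrue           = ⊤
  XSat s (neg φ)         = ¬ XSat s φ
  XSat s (conj φ ψ)      = XSat s φ × XSat s ψ
  XSat s (until ρ φ ψ)   = ∃ λ t → R⁺ 𝕄 w ρ s t × XSat t ψ ×
                             (∀ r → R⁺ 𝕄 w ρ s r → R⁺ 𝕄 w ρ r t → XSat r φ)

data PF (k : ℕ) : Set where
  atom   : Fin k → PF k
  ttrue  : PF k
  neg    : PF k → PF k
  conj   : PF k → PF k → PF k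
  disj   : PF k → PF k → PF k
  nextD  prevD  : PF k → PF k
  nextDχ prevDχ : PF k → PF k
  untilDχ sinceDχ : PF k → PF k → PF k
  nextUH prevUH : PF k → PF k
  untilUH sinceUH : PF k → PF k → PF k
  nextχ prevχ : Prec → PF k → PF k       -- ○^π_χ, ⊖^π_χ  (π ∈ {⋖, ≐})
  nextLt prevLt : PF k → PF k

data PathU (S : ℕ → ℕ → Set) (P : ℕ → Set) : ℕ → ℕ → Set where
  done : ∀ {j} → PathU S P j j
  step : ∀ {p q j} → P p → S p q → PathU S P q j → PathU S P p j

data PathS (S : ℕ → ℕ → Set) (P : ℕ → Set) : ℕ → ℕ → Set where
  done : ∀ {j} → PathS S P j j
  step : ∀ {p q j} → S p q → P q → PathS S P q j → PathS S P p j

module _ {k : ℕ} (𝕄 : OPM k) {n : ℕ} (w : Vec (Subset k) n) where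
  private
    PR' = PR 𝕄 w
    χ' = χ 𝕄 w
    LE = LtEq 𝕄 w

  DStep : ℕ → ℕ → ℕ → Set
  DStep j p q =
    (χ' p q × LE p q × q ≤ j × (∀ h → h ≤ j → χ' p h → LE p h → h ≤ q))
    ⊎ ((∀ h → h ≤ j → χ' p h → ¬ LE p h) × (q ≡ suc p) × LE p (suc p))

  UStep : ℕ → ℕ → ℕ → Set
  UStep h p q = p < q × χ' h q × PR' h ⋖ q × (∀ m → p < m → m < q → ¬ χ' h m)

  PSat : ℕ → PF k → Set
  PSat i (atom a)   = Holds 𝕄 w a i
  PSat i ttrue      = ⊤
  PSat i (neg θ)    = ¬ PSat i θ
  PSat i (conj θ η) = PSat i θ × PSat i η
  PSat i (disj θ η) = PSat i θ ⊎ PSat i η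
  PSat i (nextD θ)  = LE i (suc i) × PSat (suc i) θ
  PSat zero (prevD θ)    = ⊥
  PSat (suc i) (prevD θ) = LE i (suc i) × PSat i θ
  PSat i (nextDχ θ) = ∃ λ j → i < j × χ' i j × LE i j × PSat j θ
  PSat i (prevDχ θ) = ∃ λ j → j < i × χ' j i × LE j i × PSat j θ
  PSat i (untilDχ θ η) = ∃ λ j → i ≤ j × PathU (DStep j) (λ x → PSat x θ) i j × PSat j η
  PSat i (sinceDχ θ η) = ∃ λ j → j ≤ i × PathS (DStep i) (λ x → PSat x θ) j i × PSat j η
  PSat i (nextUH θ) = ∃₂ λ h j → h < i × χ' h i × PR' h ⋖ i ×
    i < j × χ' h j × PR' h ⋖ j × (∀ m → i < m → m < j → ¬ (χ' h m × PR' h ⋖ m)) × PSat j θ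
  PSat i (prevUH θ) = ∃₂ λ h j → h < i × χ' h i × PR' h ⋖ i ×
    j < i × χ' h j × PR' h ⋖ j × (∀ m → j < m → m < i → ¬ (χ' h m × PR' h ⋖ m)) × PSat j θ
  PSat i (untilUH θ η) = ∃₂ λ h j → i ≤ j × h < i × χ' h i × PR' h ⋖ i ×
    PathU (UStep h) (λ x → PSat x θ) i j × PSat j η
  PSat i (sinceUH θ η) = ∃₂ λ h j → j ≤ i × h < j × χ' h j × PR' h ⋖ j ×
    PathS (UStep h) (λ x → PSat x θ) j i × PSat j η
  PSat i (nextχ π θ) = ∃ λ j → χ' i j × PR' i π j × PSat j θ
  PSat i (prevχ π θ) = ∃ λ j → j < i × χ' j i × PR' j π i × PSat j θ
  PSat i (nextLt θ) = PR' i ⋖ (suc i) × PSat (suc i) θ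
  PSat zero (prevLt θ)    = ⊥
  PSat (suc i) (prevLt θ) = PR' i ⋖ (suc i) × PSat i θ

infixr 4 _∨'_
infixr 5 _∧'_
_∨'_ _∧'_ : ∀ {k} → PF k → PF k → PF k
_∨'_ = disj
_∧'_ = conj

ι : ∀ {k} → XF k → PF k
ι (atom a)  = atom a
ι ttrue     = ttrue
ι (neg φ)   = neg (ι φ)
ι (conj φ ψ) = conj (ι φ) (ι ψ)
ι (until ⇓ φ ψ) = nextD (untilDχ (ι φ) (ι ψ)) ∨' nextDχ (untilDχ (ι φ) (ι ψ))
ι (until ⇑ φ ψ) = prevD (sinceDχ (ι φ) (ι ψ)) ∨' prevDχ (sinceDχ (ι φ) (ι ψ))
ι (until ⇒ φ ψ) =
  nextUH (untilUH (ι φ) (ι ψ))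
  ∨' (neg (nextUH (untilUH ttrue (neg (ι φ)))) ∧' prevχ ⋖ (nextχ ≐ (ι ψ)))
  ∨' prevLt (nextχ ⋖ (ι ψ ∧' neg (prevUH (sinceUH ttrue (neg (ι φ))))))
  ∨' prevLt (nextχ ≐ (ι ψ) ∧' neg (nextχ ⋖ (neg (ι φ))))
ι (until ⇐ φ ψ) =
  prevUH (sinceUH (ι φ) (ι ψ))
  ∨' prevχ ≐ (nextχ ⋖ (neg (nextUH ttrue) ∧' sinceUH (ι φ) (ι ψ)))
  ∨' (prevχ ⋖ (nextLt (ι ψ)) ∧' neg (prevUH (sinceUH ttrue (neg (ι φ)))))
  ∨' prevχ ≐ (nextLt (ι ψ) ∧' neg (nextχ ⋖ (neg (ι φ))))

-- Let τ(p) be the parent of τ(i). The children of τ(p) are τ(p+1), present when p ⋖ p+1 or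
-- p ≐ p+1, followed by the τ(j) with χ(p,j) and p ⋖ j or p ≐ j in increasing order of j, so
-- ⇒(φ,ψ) holds at τ(i) iff some later such j satisfies ψ and those strictly between satisfy φ.
-- Chains are properly nested; hence if two chains share the left context p then p ⋖ y for the
-- smaller right context y, and a position is the right context of at most one chain whose left
-- context is ⋖ or ≐ to it. So the χ-children j with p ⋖ j precede the only possible one with
-- p ≐ j and are exactly the positions on the upward hierarchical paths of p, and each disjunct of
-- ι(⇒(φ,ψ)) covers one combination of τ(i) being the first child or a χ-child and the witness
-- being a ⋖- or a ≐-child. The negated subformulas are used classically, which is justified since
-- POTL satisfaction on a finite word is decidable.

module Submission where

open import Defs
open import Data.Nat using (ℕ; zero; suc; pred; _+_; _∸_; _<_; _≤_; _≤′_; ≤′-refl; ≤′-step; s≤s; z≤n;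
  _≟_; _<?_; _≤?_)
open import Data.Nat.Properties
open import Data.Fin.Subset using (Subset)
open import Data.Fin.Subset.Properties using (_∈?_)
open import Data.Vec using (Vec)
open import Data.List using (List; []; _∷_; _++_; [_]; length; filter; downFrom)
import Data.List.Properties as List
open import Data.List.Membership.Propositional using (_∈_)
open import Data.List.Membership.Propositional.Properties
  using (∈-filter⁺; ∈-filter⁻; ∈-downFrom⁺; ∈-downFrom⁻)
open import Data.List.Membership.Propositional.Properties.WithK using (unique∧set⇒bag)
open import Data.List.Relation.Unary.Unique.Propositional using (Unique)
import Data.List.Relation.Unary.Unique.Propositional.Properties as Unique
open import Data.List.Relation.Binary.BagAndSetEquality using (∼bag⇒↭)
open import Data.List.Relation.Binary.Permutation.Propositional.Properties using (↭-length)
open import Data.Maybe using (just; nothing)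
open import Data.Maybe.Properties using (just-injective; ≡-dec)
open import Data.Product using (∃; ∃₂; _×_; _,_; proj₁; proj₂)
open import Data.Sum using (_⊎_; inj₁; inj₂)
open import Data.Unit using (tt)
open import Data.Empty using (⊥; ⊥-elim)
open import Function using (_∘_)
open import Function.Bundles using (_⇔_; mk⇔; Equivalence)
open import Function.Construct.Symmetry using (⇔-sym)
open import Function.Construct.Composition using (_⇔-∘_)
open import Relation.Nullary using (¬_; Dec; yes; no; contradiction)
open import Relation.Nullary.Decidable using (map′; _×-dec_; _⊎-dec_; _→-dec_; ¬?; decidable-stable)
open import Relation.Unary using (Decidable)
open import Relation.Binary.PropositionalEquality using (_≡_; _≢_; refl; sym; trans; cong)
open import Relation.Binary using (tri<; tri≈; tri>)
open import Relation.Binary.Construct.Closure.Transitive using (_∷ʳ_) renaming ([_] to [_]⁺; _∷_ to _∷⁺_)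

_×-dec′_ : ∀ {A B : Set} → Dec A → (A → Dec B) → Dec (A × B)
yes a ×-dec′ b? = map′ (a ,_) proj₂ (b? a)
no ¬a ×-dec′ _  = no (¬a ∘ proj₁)

shift-bound : ∀ {p a x s} → p < a → x ≤ p + suc s → x ≤ a + s
shift-bound {p} {a} {x} {s} p<a x≤ = ≤-trans x≤ (≤-trans (≤-reflexive (+-suc p s)) (+-monoˡ-≤ s p<a))

module _ {P : ℕ → Set} where

  any<? : ∀ N → (∀ a → a < N → Dec (P a)) → Dec (∃ λ a → a < N × P a)
  any<? N P? = map′ (λ (a , _ , a<N , Pa) → a , a<N , Pa) (λ (a , a<N , Pa) → a , a<N , a<N , Pa)
    (anyUpTo? (λ a → (a <? N) ×-dec′ P? a) N)

  bounded-∃? : ∀ N → (∀ a → P a → a < N) → Decidable P → Dec (∃ P)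
  bounded-∃? N bound P? = map′ (λ (a , _ , Pa) → a , Pa) (λ (a , Pa) → a , bound a Pa , Pa) (anyUpTo? P? N)

  all≤? : Decidable P → ∀ N → Dec (∀ a → a ≤ N → P a)
  all≤? P? N = map′ (λ all a a≤N → all (s≤s a≤N)) (λ all {a} a<1+N → all a (m<1+n⇒m≤n a<1+N))
    (allUpTo? P? (suc N))

  allBetween? : Decidable P → ∀ a b → Dec (∀ m → a < m → m < b → P m)
  allBetween? P? a b = map′ (λ all m a<m m<b → all m<b a<m) (λ all {m} m<b a<m → all m a<m m<b)
    (allUpTo? (λ m → (a <? m) →-dec P? m) b)

module BoundedSearch {Q : ℕ → Set} (Q? : Decidable Q) where

  FirstAbove : ℕ → ℕ → Set
  FirstAbove a z = a < z × Q z × (∀ y → a < y → y < z → ¬ Q y)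

  LastBelow : ℕ → ℕ → Set
  LastBelow t z = z < t × Q z × (∀ y → z < y → y < t → ¬ Q y)

  private
    firstAbove-or-none : ∀ a b → (∃ λ z → z < b × FirstAbove a z) ⊎ (∀ y → a < y → y < b → ¬ Q y)
    firstAbove-or-none a zero = inj₂ λ _ _ ()
    firstAbove-or-none a (suc b) with firstAbove-or-none a b | (a <? b) ×-dec Q? b
    ... | inj₁ (z , z<b , first) | _ = inj₁ (z , m<n⇒m<1+n z<b , first)
    ... | inj₂ none | yes (a<b , Qb) = inj₁ (b , ≤-refl , a<b , Qb , none)
    ... | inj₂ none | no ¬Qb = inj₂ none′
      where
        none′ : ∀ y → a < y → y < suc b → ¬ Q y
        none′ y a<y y<1+b with m<1+n⇒m<n∨m≡n y<1+b
        ... | inj₁ y<b = none y a<y y<b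
        ... | inj₂ refl = ¬Qb ∘ (a<y ,_)

    lastBelow-or-none : ∀ m t → (∃ λ z → m ≤ z × LastBelow t z) ⊎ (∀ y → m ≤ y → y < t → ¬ Q y)
    lastBelow-or-none m zero = inj₂ λ _ _ ()
    lastBelow-or-none m (suc t) with (m ≤? t) ×-dec Q? t | lastBelow-or-none m t
    ... | yes (m≤t , Qt) | _ =
      inj₁ (t , m≤t , ≤-refl , Qt , λ y t<y y<1+t → contradiction (m<1+n⇒m≤n y<1+t) (<⇒≱ t<y))
    ... | no ¬Qt | inj₁ (z , m≤z , z<t , Qz , last) = inj₁ (z , m≤z , m<n⇒m<1+n z<t , Qz , last′)
      where
        last′ : ∀ y → z < y → y < suc t → ¬ Q y
        last′ y z<y y<1+t with m<1+n⇒m<n∨m≡n y<1+t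
        ... | inj₁ y<t = last y z<y y<t
        ... | inj₂ refl = ¬Qt ∘ (≤-trans m≤z (<⇒≤ z<t) ,_)
    ... | no ¬Qt | inj₂ none = inj₂ none′
      where
        none′ : ∀ y → m ≤ y → y < suc t → ¬ Q y
        none′ y m≤y y<1+t with m<1+n⇒m<n∨m≡n y<1+t
        ... | inj₁ y<t = none y m≤y y<t
        ... | inj₂ refl = ¬Qt ∘ (m≤y ,_)

  firstAbove : ∀ {a b} → a < b → Q b → ∃ λ z → z ≤ b × FirstAbove a z
  firstAbove {a} {b} a<b Qb with firstAbove-or-none a (suc b)
  ... | inj₁ (z , z<1+b , first) = z , m<1+n⇒m≤n z<1+b , first
  ... | inj₂ none = contradiction Qb (none b a<b ≤-refl)

  lastBelow : ∀ {m t} → m < t → Q m → ∃ λ z → m ≤ z × LastBelow t z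
  lastBelow {m} {t} m<t Qm with lastBelow-or-none m t
  ... | inj₁ found = found
  ... | inj₂ none = contradiction Qm (none m ≤-refl m<t)

module Counting {P : ℕ → Set} (P? : Decidable P) where

  below : ℕ → List ℕ
  below j = filter P? (downFrom j)

  count : ℕ → ℕ
  count j = length (below j)

  below-unique : ∀ j → Unique (below j)
  below-unique j = Unique.filter⁺ P? (Unique.downFrom⁺ j)

  ∈-below : ∀ j x → x ∈ below j ⇔ (x < j × P x)
  ∈-below j x = mk⇔ (λ x∈ → let x∈↓ , Px = ∈-filter⁻ P? x∈ in ∈-downFrom⁻ x∈↓ , Px)
                     (λ (x<j , Px) → ∈-filter⁺ P? (∈-downFrom⁺ x<j) Px)

  count-unique : ∀ {L j} → Unique L → (∀ x → x ∈ L ⇔ (x < j × P x)) → length L ≡ count j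
  count-unique {L} {j} L-unique L-members = ↭-length (∼bag⇒↭
    (unique∧set⇒bag L-unique (below-unique j) (λ {x} → ⇔-sym (∈-below j x) ⇔-∘ L-members x)))

  count-accept : ∀ {j} → P j → count (suc j) ≡ suc (count j)
  count-accept Pj = cong length (List.filter-accept P? Pj)

  count-reject : ∀ {j} → ¬ P j → count (suc j) ≡ count j
  count-reject ¬Pj = cong length (List.filter-reject P? ¬Pj)

  count-step : ∀ j → count j ≤ count (suc j)
  count-step j = by-cases (P? j)
    where
      by-cases : Dec (P j) → count j ≤ count (suc j)
      by-cases (yes Pj) = ≤-trans (n≤1+n _) (≤-reflexive (sym (count-accept Pj)))
      by-cases (no ¬Pj) = ≤-reflexive (sym (count-reject ¬Pj))

  count-mono : ∀ {a b} → a ≤ b → count a ≤ count b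
  count-mono = count-mono′ ∘ ≤⇒≤′
    where
      count-mono′ : ∀ {a b} → a ≤′ b → count a ≤ count b
      count-mono′ ≤′-refl = ≤-refl
      count-mono′ (≤′-step a≤′b) = ≤-trans (count-mono′ a≤′b) (count-step _)

  count-strict : ∀ {a b} → P a → a < b → count a < count b
  count-strict Pa a<b = ≤-trans (≤-reflexive (sym (count-accept Pa))) (count-mono a<b)

  count-reflects-< : ∀ {a b} → count a < count b → a < b
  count-reflects-< {a} {b} lt with a <? b
  ... | yes a<b = a<b
  ... | no a≮b = contradiction (count-mono (≮⇒≥ a≮b)) (<⇒≱ lt)

  count-injective : ∀ {a b} → P a → P b → count a ≡ count b → a ≡ b
  count-injective {a} {b} Pa Pb eq with <-cmp a b
  ... | tri< a<b _ _ = contradiction eq (<⇒≢ (count-strict Pa a<b))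
  ... | tri≈ _ a≡b _ = a≡b
  ... | tri> _ _ b<a = contradiction (sym eq) (<⇒≢ (count-strict Pb b<a))

  count-surjective : ∀ {c} j → c < count j → ∃ λ a → a < j × P a × count a ≡ c
  count-surjective {c} (suc j) c<count = by-cases (P? j)
    where
      widen : (∃ λ a → a < j × P a × count a ≡ c) → ∃ λ a → a < suc j × P a × count a ≡ c
      widen (a , a<j , Pa , eq) = a , m<n⇒m<1+n a<j , Pa , eq
      by-cases : Dec (P j) → ∃ λ a → a < suc j × P a × count a ≡ c
      by-cases (no ¬Pj) = widen (count-surjective j (≤-trans c<count (≤-reflexive (count-reject ¬Pj))))
      by-cases (yes Pj) with m<1+n⇒m<n∨m≡n (≤-trans c<count (≤-reflexive (count-accept Pj)))
      ... | inj₁ c<count′ = widen (count-surjective j c<count′)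
      ... | inj₂ refl = j , ≤-refl , Pj , refl

module _ {S : ℕ → ℕ → Set} {P : ℕ → Set} where

  PathU-last : ∀ {a b} → PathU S P a b → a ≡ b ⊎ ∃ λ p → S p b
  PathU-last done = inj₁ refl
  PathU-last (step _ s rest) with PathU-last rest
  ... | inj₁ refl = inj₂ (_ , s)
  ... | inj₂ last = inj₂ last

  PathS-last : ∀ {a b} → PathS S P a b → a ≡ b ⊎ ∃ λ p → S p b
  PathS-last done = inj₁ refl
  PathS-last (step s _ rest) with PathS-last rest
  ... | inj₁ refl = inj₂ (_ , s)
  ... | inj₂ last = inj₂ last

module PathDecision {S : ℕ → ℕ → Set} {P : ℕ → Set} (S? : ∀ p q → Dec (S p q)) (P? : Decidable P)
                    (S-increasing : ∀ {p q} → S p q → p < q) where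

  PathU-≤ : ∀ {a b} → PathU S P a b → a ≤ b
  PathU-≤ done = ≤-refl
  PathU-≤ (step _ s rest) = ≤-trans (<⇒≤ (S-increasing s)) (PathU-≤ rest)

  PathS-≤ : ∀ {a b} → PathS S P a b → a ≤ b
  PathS-≤ done = ≤-refl
  PathS-≤ (step s _ rest) = ≤-trans (<⇒≤ (S-increasing s)) (PathS-≤ rest)

  private
    fuel-empty : ∀ {a b} → a ≤ b → b ≤ a + 0 → a ≡ b
    fuel-empty {a} a≤b b≤ = ≤-antisym a≤b (≤-trans b≤ (≤-reflexive (+-identityʳ a)))

    pathU? : ∀ d a b → b ≤ a + d → Dec (PathU S P a b)
    pathU? zero a b b≤ with a ≟ b
    ... | yes refl = yes done
    ... | no a≢b = no λ path → a≢b (fuel-empty (PathU-≤ path) b≤)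
    pathU? (suc d) a b b≤ = map′ from to ((a ≟ b) ⊎-dec anyUpTo? first-step? (suc b))
      where
        first-step? : ∀ q → Dec (S a q × P a × PathU S P q b)
        first-step? q = S? a q ×-dec′ λ s → P? a ×-dec pathU? d q b (shift-bound (S-increasing s) b≤)
        from : a ≡ b ⊎ (∃ λ q → q < suc b × S a q × P a × PathU S P q b) → PathU S P a b
        from (inj₁ refl) = done
        from (inj₂ (_ , _ , s , Pa , rest)) = step Pa s rest
        to : PathU S P a b → a ≡ b ⊎ (∃ λ q → q < suc b × S a q × P a × PathU S P q b)
        to done = inj₁ refl
        to (step Pa s rest) = inj₂ (_ , s≤s (PathU-≤ rest) , s , Pa , rest)

    pathS? : ∀ d a b → b ≤ a + d → Dec (PathS S P a b)
    pathS? zero a b b≤ with a ≟ b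
    ... | yes refl = yes done
    ... | no a≢b = no λ path → a≢b (fuel-empty (PathS-≤ path) b≤)
    pathS? (suc d) a b b≤ = map′ from to ((a ≟ b) ⊎-dec anyUpTo? first-step? (suc b))
      where
        first-step? : ∀ q → Dec (S a q × P q × PathS S P q b)
        first-step? q = S? a q ×-dec′ λ s → P? q ×-dec pathS? d q b (shift-bound (S-increasing s) b≤)
        from : a ≡ b ⊎ (∃ λ q → q < suc b × S a q × P q × PathS S P q b) → PathS S P a b
        from (inj₁ refl) = done
        from (inj₂ (_ , _ , s , Pq , rest)) = step s Pq rest
        to : PathS S P a b → a ≡ b ⊎ (∃ λ q → q < suc b × S a q × P q × PathS S P q b)
        to done = inj₁ refl
        to (step s Pq rest) = inj₂ (_ , s≤s (PathS-≤ rest) , s , Pq , rest)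

  PathU? : ∀ a b → Dec (PathU S P a b)
  PathU? a b = pathU? b a b (m≤n+m b a)

  PathS? : ∀ a b → Dec (PathS S P a b)
  PathS? a b = pathS? b a b (m≤n+m b a)

module OPWord {k : ℕ} (𝕄 : OPM k) {n : ℕ} (w : Vec (Subset k) n) where

  private
    Ch Gp Eqs χʷ : ℕ → ℕ → Set
    Ch = Chain 𝕄 w
    Gp = Gap 𝕄 w
    Eqs = EqSeq 𝕄 w
    χʷ = χ 𝕄 w
    _⋖ʷ_ _≐ʷ_ : ℕ → ℕ → Set
    i ⋖ʷ j = PR 𝕄 w i ⋖ j
    i ≐ʷ j = PR 𝕄 w i ≐ j

  -- Precedences and chains

  -- PR is not injective in its positions; the wrapper lets Agda infer them.
  record Pr (i : ℕ) (π : Prec) (j : ℕ) : Set where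
    constructor pr
    field prec : PR 𝕄 w i π j
  open Pr public

  Pr-functional : ∀ {i j π π′} → Pr i π j → Pr i π′ j → π ≡ π′
  Pr-functional (pr p) (pr q) = just-injective (trans (sym p) q)

  ⋖⇒¬≐ : ∀ {i j} → Pr i ⋖ j → ¬ Pr i ≐ j
  ⋖⇒¬≐ p q with Pr-functional p q
  ... | ()

  ⋖⇒¬⋗ : ∀ {i j} → Pr i ⋖ j → ¬ Pr i ⋗ j
  ⋖⇒¬⋗ p q with Pr-functional p q
  ... | ()

  ≐⇒¬⋗ : ∀ {i j} → Pr i ≐ j → ¬ Pr i ⋗ j
  ≐⇒¬⋗ p q with Pr-functional p q
  ... | ()

  LtEq⇒¬⋗ : ∀ {i j} → LtEq 𝕄 w i j → ¬ Pr i ⋗ j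
  LtEq⇒¬⋗ (inj₁ i⋖j) = ⋖⇒¬⋗ (pr i⋖j)
  LtEq⇒¬⋗ (inj₂ i≐j) = ≐⇒¬⋗ (pr i≐j)

  chain-first-⋖ : ∀ {i j} → Ch i j → Pr i ⋖ (suc i)
  chain-first-⋖ (chain i⋖a adj _ _ _) = pr i⋖a
  chain-first-⋖ (chain _ (sub c) _ _ _) = chain-first-⋖ c

  chain-last-⋗ : ∀ {i j} → Ch i j → Pr (pred j) ⋗ j
  chain-last-⋗ (chain _ _ _ b⋗j adj) = pr b⋗j
  chain-last-⋗ (chain _ _ _ _ (sub c)) = chain-last-⋗ c

  mutual
    chain-wide : ∀ {i j} → Ch i j → suc i < j
    chain-wide (chain _ first body _ last) =
      <-≤-trans (s≤s (gap-< first)) (≤-trans (s≤s (eqSeq-≤ body)) (gap-< last))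

    gap-< : ∀ {p q} → Gp p q → p < q
    gap-< adj = n<1+n _
    gap-< (sub c) = <-trans (n<1+n _) (chain-wide c)

    eqSeq-≤ : ∀ {a b} → Eqs a b → a ≤ b
    eqSeq-≤ one = ≤-refl
    eqSeq-≤ (step _ g rest) = ≤-trans (<⇒≤ (gap-< g)) (eqSeq-≤ rest)

  chain-< : ∀ {i j} → Ch i j → i < j
  chain-< c = <-trans (n<1+n _) (chain-wide c)

  nonempty-gap : ∀ {p q m} → Gp p q → p < m → m < q → Ch p q
  nonempty-gap adj p<m m<1+p = contradiction p<m (≤⇒≯ (m<1+n⇒m≤n m<1+p))
  nonempty-gap (sub c) _ _ = c

  data Inside (i j m : ℕ) : Set where
    in-subchain : ∀ {c c′} → Ch c c′ → c < m → m < c′ → (c ≡ i × c′ < j) ⊎ (i < c × c′ ≤ j) →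
                  Inside i j m
    in-body : ∀ {e′ e} → Gp e′ m → (e′ ≡ i × Pr i ⋖ m) ⊎ (i < e′ × Pr e′ ≐ m) →
              Gp m e → (e ≡ j × Pr m ⋗ j) ⊎ (e < j × Pr m ≐ e) → Inside i j m

  private
    BodyPredecessor : ℕ → ℕ → Set
    BodyPredecessor i a = ∃ λ e′ → Gp e′ a × ((e′ ≡ i × Pr i ⋖ a) ⊎ (i < e′ × Pr e′ ≐ a))

    inside-body : ∀ {i j a b m} → Eqs a b → PR 𝕄 w b ⋗ j → Gp b j → BodyPredecessor i a →
                  i < a → a ≤ m → m < j → Inside i j m
    inside-body {a = a} {m = m} one b⋗j last (_ , g′ , before) i<a a≤m m<j with <-cmp a m
    ... | tri≈ _ refl _ = in-body g′ before last (inj₁ (refl , pr b⋗j))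
    ... | tri> _ _ m<a = contradiction a≤m (<⇒≱ m<a)
    ... | tri< a<m _ _ = in-subchain (nonempty-gap last a<m m<j) a<m m<j (inj₂ (i<a , ≤-refl))
    inside-body {a = a} {m = m} (step {b = c} a≐c g rest) b⋗j last (_ , g′ , before) i<a a≤m m<j
      with <-cmp a m
    ... | tri≈ _ refl _ = in-body g′ before g (inj₂ (≤-<-trans (eqSeq-≤ rest) (gap-< last) , pr a≐c))
    ... | tri> _ _ m<a = contradiction a≤m (<⇒≱ m<a)
    ... | tri< a<m _ _ with <-cmp m c
    ...   | tri< m<c _ _ = in-subchain (nonempty-gap g a<m m<c) a<m m<c
                             (inj₂ (i<a , <⇒≤ (≤-<-trans (eqSeq-≤ rest) (gap-< last))))
    ...   | tri≈ _ refl _ =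
      inside-body rest b⋗j last (a , g , inj₂ (i<a , pr a≐c)) (<-trans i<a (gap-< g)) ≤-refl m<j
    ...   | tri> _ _ c<m =
      inside-body rest b⋗j last (a , g , inj₂ (i<a , pr a≐c)) (<-trans i<a (gap-< g)) (<⇒≤ c<m) m<j

  inside : ∀ {i j m} → Ch i j → i < m → m < j → Inside i j m
  inside {i} {j} {m} (chain {a = a} i⋖a first body b⋗j last) i<m m<j with <-cmp m a
  ... | tri< m<a _ _ =
    in-subchain (nonempty-gap first i<m m<a) i<m m<a (inj₁ (refl , ≤-<-trans (eqSeq-≤ body) (gap-< last)))
  ... | tri≈ _ refl _ = inside-body body b⋗j last (i , first , inj₁ (refl , pr i⋖a)) (gap-< first) ≤-refl m<j
  ... | tri> _ _ a<m = inside-body body b⋗j last (i , first , inj₁ (refl , pr i⋖a)) (gap-< first) (<⇒≤ a<m) m<j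

  private
    nested-span< : ∀ {i j c c′} → i ≤ c → c′ ≤ j → c ≤ c′ → (i < c ⊎ c′ < j) → c′ ∸ c < j ∸ i
    nested-span< {i} {j} {c} {c′} i≤c c′≤j c≤c′ (inj₁ i<c) =
      ≤-<-trans (∸-monoˡ-≤ c c′≤j) (∸-monoʳ-< i<c (≤-trans c≤c′ c′≤j))
    nested-span< {i} {j} {c} {c′} i≤c c′≤j c≤c′ (inj₂ c′<j) =
      ≤-<-trans (∸-monoʳ-≤ c′ i≤c) (∸-monoˡ-< c′<j (≤-trans i≤c c≤c′))

    shrinkˡ : ∀ {x x′ y f} → x′ < x → x + y < suc f → x′ + y < f
    shrinkˡ {y = y} x′<x bound = <-≤-trans (+-monoˡ-< y x′<x) (m<1+n⇒m≤n bound)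

    shrinkʳ : ∀ {x y y′ f} → y′ < y → x + y < suc f → x + y′ < f
    shrinkʳ {x = x} y′<y bound = <-≤-trans (+-monoʳ-< x y′<y) (m<1+n⇒m≤n bound)

    next-≤ : ∀ {e j} {A B : Set} → (e ≡ j × A) ⊎ (e < j × B) → e ≤ j
    next-≤ (inj₁ (refl , _)) = ≤-refl
    next-≤ (inj₂ (e<j , _)) = <⇒≤ e<j

    -- Every call descends into a subchain produced by `inside`; the fuel bounds the widths of
    -- the two chains involved.
    mutual
      no-crossing : ∀ f {i j i′ j′} → Ch i j → Ch i′ j′ → (j ∸ i) + (j′ ∸ i′) < f →
                    i < i′ → i′ < j → j < j′ → ⊥
      no-crossing (suc f) {i} {j} {i′} {j′} A B bound i<i′ i′<j j<j′ with inside A i<i′ i′<j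
      ... | in-subchain C c<i′ i′<c′ (inj₁ (refl , c′<j)) =
        no-crossing f C B
          (shrinkˡ (nested-span< ≤-refl (<⇒≤ c′<j) (<⇒≤ (<-trans c<i′ i′<c′)) (inj₂ c′<j)) bound)
          c<i′ i′<c′ (<-trans c′<j j<j′)
      ... | in-subchain C c<i′ i′<c′ (inj₂ (i<c , c′≤j)) =
        no-crossing f C B
          (shrinkˡ (nested-span< (<⇒≤ i<c) c′≤j (<⇒≤ (<-trans c<i′ i′<c′)) (inj₁ i<c)) bound)
          c<i′ i′<c′ (≤-<-trans c′≤j j<j′)
      ... | in-body _ _ adj (inj₁ (refl , i′⋗j)) = ⋖⇒¬⋗ (chain-first-⋖ B) i′⋗j
      ... | in-body _ _ adj (inj₂ (_ , i′≐e)) = ⋖⇒¬≐ (chain-first-⋖ B) i′≐e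
      ... | in-body _ _ (sub {q = e} C) next = ⋖⇒¬≐⋗ next
        where
          e≤j : e ≤ j
          e≤j = next-≤ next
          i′⋖e : Pr i′ ⋖ e
          i′⋖e = shared-left f C B (≤-<-trans e≤j j<j′)
                   (shrinkˡ (nested-span< (<⇒≤ i<i′) e≤j (<⇒≤ (chain-< C)) (inj₁ i<i′)) bound)
          ⋖⇒¬≐⋗ : (e ≡ j × Pr i′ ⋗ j) ⊎ (e < j × Pr i′ ≐ e) → ⊥
          ⋖⇒¬≐⋗ (inj₁ (refl , i′⋗j)) = ⋖⇒¬⋗ i′⋖e i′⋗j
          ⋖⇒¬≐⋗ (inj₂ (_ , i′≐e)) = ⋖⇒¬≐ i′⋖e i′≐e

      shared-left : ∀ f {x y y′} → Ch x y → Ch x y′ → y < y′ → (y ∸ x) + (y′ ∸ x) < f → Pr x ⋖ y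
      shared-left (suc f) {x} {y} {y′} A B y<y′ bound with inside B (chain-< A) y<y′
      ... | in-subchain C c<y y<c′ (inj₁ (refl , c′<y′)) =
        shared-left f A C y<c′
          (shrinkʳ (nested-span< ≤-refl (<⇒≤ c′<y′) (<⇒≤ (<-trans c<y y<c′)) (inj₂ c′<y′)) bound)
      ... | in-subchain C c<y y<c′ (inj₂ (x<c , c′≤y′)) =
        ⊥-elim (no-crossing f A C
          (shrinkʳ (nested-span< (<⇒≤ x<c) c′≤y′ (<⇒≤ (<-trans c<y y<c′)) (inj₁ x<c)) bound) x<c c<y y<c′)
      ... | in-body _ (inj₁ (refl , x⋖y)) _ _ = x⋖y
      ... | in-body adj (inj₂ (_ , e′≐y)) _ _ = ⊥-elim (≐⇒¬⋗ e′≐y (chain-last-⋗ A))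
      ... | in-body (sub C) (inj₂ (x<e′ , e′≐y)) _ _ =
        ⊥-elim (≐⇒¬⋗ e′≐y (shared-right f A C x<e′
          (shrinkʳ (nested-span< (<⇒≤ x<e′) (<⇒≤ y<y′) (<⇒≤ (chain-< C)) (inj₁ x<e′)) bound)))

      shared-right : ∀ f {x x′ y} → Ch x y → Ch x′ y → x < x′ → (y ∸ x) + (y ∸ x′) < f → Pr x′ ⋗ y
      shared-right (suc f) {x} {x′} {y} A B x<x′ bound with inside A x<x′ (chain-< B)
      ... | in-subchain C c<x′ x′<c′ (inj₁ (refl , c′<y)) =
        ⊥-elim (no-crossing f C B
          (shrinkˡ (nested-span< ≤-refl (<⇒≤ c′<y) (<⇒≤ (<-trans c<x′ x′<c′)) (inj₂ c′<y)) bound)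
          c<x′ x′<c′ c′<y)
      ... | in-subchain C c<x′ x′<c′ (inj₂ (x<c , c′≤y)) with m≤n⇒m<n∨m≡n c′≤y
      ...   | inj₁ c′<y = ⊥-elim (no-crossing f C B
                (shrinkˡ (nested-span< (<⇒≤ x<c) c′≤y (<⇒≤ (<-trans c<x′ x′<c′)) (inj₁ x<c)) bound)
                c<x′ x′<c′ c′<y)
      ...   | inj₂ refl = shared-right f C B c<x′
                (shrinkˡ (nested-span< (<⇒≤ x<c) c′≤y (<⇒≤ (<-trans c<x′ x′<c′)) (inj₁ x<c)) bound)
      shared-right (suc f) A B x<x′ bound | in-body _ _ _ (inj₁ (refl , x′⋗y)) = x′⋗y
      shared-right (suc f) A B x<x′ bound | in-body _ _ adj (inj₂ (_ , x′≐e)) =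
        ⊥-elim (⋖⇒¬≐ (chain-first-⋖ B) x′≐e)
      shared-right (suc f) A B x<x′ bound | in-body _ _ (sub C) (inj₂ (e<y , x′≐e)) =
        ⊥-elim (⋖⇒¬≐ (shared-left f C B e<y
          (shrinkˡ (nested-span< (<⇒≤ x<x′) (<⇒≤ e<y) (<⇒≤ (chain-< C)) (inj₁ x<x′)) bound)) x′≐e)

  shared-left-⋖ : ∀ {x y y′} → Ch x y → Ch x y′ → y < y′ → Pr x ⋖ y
  shared-left-⋖ A B y<y′ = shared-left _ A B y<y′ ≤-refl

  shared-right-⋗ : ∀ {x x′ y} → Ch x y → Ch x′ y → x < x′ → Pr x′ ⋗ y
  shared-right-⋗ A B x<x′ = shared-right _ A B x<x′ ≤-refl

  LtEq-parent-unique : ∀ {h p i} → Ch h i → LtEq 𝕄 w h i → Ch p i → LtEq 𝕄 w p i → h ≡ p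
  LtEq-parent-unique {h} {p} A h≤i B p≤i with <-cmp h p
  ... | tri< h<p _ _ = ⊥-elim (LtEq⇒¬⋗ p≤i (shared-right-⋗ A B h<p))
  ... | tri≈ _ h≡p _ = h≡p
  ... | tri> _ _ p<h = ⊥-elim (LtEq⇒¬⋗ h≤i (shared-right-⋗ B A p<h))

  -- Decidability

  _≟ᴾ_ : (π π′ : Prec) → Dec (π ≡ π′)
  ⋖ ≟ᴾ ⋖ = yes refl
  ≐ ≟ᴾ ≐ = yes refl
  ⋗ ≟ᴾ ⋗ = yes refl
  ⋖ ≟ᴾ ≐ = no λ ()
  ⋖ ≟ᴾ ⋗ = no λ ()
  ≐ ≟ᴾ ⋖ = no λ ()
  ≐ ≟ᴾ ⋗ = no λ ()
  ⋗ ≟ᴾ ⋖ = no λ ()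
  ⋗ ≟ᴾ ≐ = no λ ()

  PR? : ∀ i π j → Dec (PR 𝕄 w i π j)
  PR? i π j = ≡-dec _≟ᴾ_ (cmp 𝕄 w i j) (just π)

  Pr? : ∀ i π j → Dec (Pr i π j)
  Pr? i π j = map′ pr prec (PR? i π j)

  N : ℕ
  N = length (hw 𝕄 w)

  private
    at-bound : ∀ {A : Set} (xs : List A) p {x} → at xs p ≡ just x → p < length xs
    at-bound (_ ∷ _) zero _ = s≤s z≤n
    at-bound (_ ∷ xs) (suc p) eq = s≤s (at-bound xs p eq)

  PR-bound : ∀ i {π j} → PR 𝕄 w i π j → j < N
  PR-bound i {π} {j} i∼j with symAt 𝕄 w i | symAt 𝕄 w j in eq
  ... | just _ | just _ = at-bound (hw 𝕄 w) j eq
  ... | just _ | nothing = case-nothing i∼j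
    where case-nothing : ∀ {x} → nothing ≡ just x → j < N
          case-nothing ()
  PR-bound i () | nothing | _

  chain-bound : ∀ {i j} → Ch i j → j < N
  chain-bound {j = j} c = PR-bound (pred j) (prec (chain-last-⋗ c))

  LtEq-bound : ∀ {i j} → LtEq 𝕄 w i j → j < N
  LtEq-bound {i} (inj₁ i⋖j) = PR-bound i i⋖j
  LtEq-bound {i} (inj₂ i≐j) = PR-bound i i≐j

  private
    ChainParts GapParts EqSeqParts : ℕ → ℕ → Set
    ChainParts p q = ∃ λ a → a < q × Gp p a × Pr p ⋖ a × ∃ λ b → b < q × Eqs a b × Pr b ⋗ q × Gp b q
    GapParts p q = q ≡ suc p ⊎ Ch p q
    EqSeqParts p q = p ≡ q ⊎ ∃ λ c → c < suc q × Gp p c × Pr p ≐ c × Eqs c q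

    chain-parts : ∀ {p q} → Ch p q → ChainParts p q
    chain-parts (chain p⋖a first body b⋗q last) =
      _ , ≤-<-trans (eqSeq-≤ body) (gap-< last) , first , pr p⋖a , _ , gap-< last , body , pr b⋗q , last

    from-chain-parts : ∀ {p q} → ChainParts p q → Ch p q
    from-chain-parts (_ , _ , first , pr p⋖a , _ , _ , body , pr b⋗q , last) = chain p⋖a first body b⋗q last

    gap-parts : ∀ {p q} → Gp p q → GapParts p q
    gap-parts adj = inj₁ refl
    gap-parts (sub c) = inj₂ c

    from-gap-parts : ∀ {p q} → GapParts p q → Gp p q
    from-gap-parts (inj₁ refl) = adj
    from-gap-parts (inj₂ c) = sub c

    eqSeq-parts : ∀ {p q} → Eqs p q → EqSeqParts p q
    eqSeq-parts one = inj₁ refl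
    eqSeq-parts (step p≐c g rest) = inj₂ (_ , s≤s (eqSeq-≤ rest) , g , pr p≐c , rest)

    from-eqSeq-parts : ∀ {p q} → EqSeqParts p q → Eqs p q
    from-eqSeq-parts (inj₁ refl) = one
    from-eqSeq-parts (inj₂ (_ , _ , g , pr p≐c , rest)) = step p≐c g rest

    record DecidableWithin (s : ℕ) : Set where
      field
        chain? : ∀ p q → q ≤ p + s → Dec (Ch p q)
        gap? : ∀ p q → q ≤ p + s → Dec (Gp p q)
        eqSeq? : ∀ p q → q ≤ p + s → Dec (Eqs p q)

    decidableWithin-0 : DecidableWithin 0
    decidableWithin-0 = record
      { chain? = λ p q q≤p+0 → no λ c → <⇒≱ (chain-< c) (≤-trans q≤p+0 (≤-reflexive (+-identityʳ p)))
      ; gap? = λ p q q≤p+0 → no λ g → <⇒≱ (gap-< g) (≤-trans q≤p+0 (≤-reflexive (+-identityʳ p)))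
      ; eqSeq? = λ p q q≤p+0 → map′ (λ { refl → one })
                   (λ e → ≤-antisym (eqSeq-≤ e) (≤-trans q≤p+0 (≤-reflexive (+-identityʳ p)))) (p ≟ q)
      }

    decidableWithin-suc : ∀ {s} → DecidableWithin s → DecidableWithin (suc s)
    decidableWithin-suc {s} D = record { chain? = chain? ; gap? = gap? ; eqSeq? = eqSeq? }
      where
        module D = DecidableWithin D
        below-bound : ∀ {p a q} → a < q → q ≤ p + suc s → a ≤ p + s
        below-bound {p} a<q q≤ = m<1+n⇒m≤n (<-≤-trans a<q (≤-trans q≤ (≤-reflexive (+-suc p s))))

        chain? : ∀ p q → q ≤ p + suc s → Dec (Ch p q)
        chain? p q q≤ = map′ from-chain-parts chain-parts (any<? q λ a a<q →
          D.gap? p a (below-bound a<q q≤) ×-dec′ λ first → Pr? p ⋖ a ×-dec any<? q λ b b<q →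
            D.eqSeq? a b (shift-bound (gap-< first) (<⇒≤ (<-≤-trans b<q q≤))) ×-dec′ λ body →
              Pr? b ⋗ q ×-dec D.gap? b q (shift-bound (<-≤-trans (gap-< first) (eqSeq-≤ body)) q≤))

        gap? : ∀ p q → q ≤ p + suc s → Dec (Gp p q)
        gap? p q q≤ = map′ from-gap-parts gap-parts ((q ≟ suc p) ⊎-dec chain? p q q≤)

        eqSeq? : ∀ p q → q ≤ p + suc s → Dec (Eqs p q)
        eqSeq? p q q≤ = map′ from-eqSeq-parts eqSeq-parts ((p ≟ q) ⊎-dec any<? (suc q) λ c c<1+q →
          gap? p c (≤-trans (m<1+n⇒m≤n c<1+q) q≤) ×-dec′ λ g →
            Pr? p ≐ c ×-dec D.eqSeq? c q (shift-bound (gap-< g) q≤))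

    decidableWithin : ∀ s → DecidableWithin s
    decidableWithin zero = decidableWithin-0
    decidableWithin (suc s) = decidableWithin-suc (decidableWithin s)

  Chain? : ∀ p q → Dec (Ch p q)
  Chain? p q = DecidableWithin.chain? (decidableWithin q) p q (m≤n+m q p)

  χ? : ∀ i j → Dec (χʷ i j)
  χ? i j = (suc i <? j) ×-dec Chain? i j

  LtEq? : ∀ i j → Dec (LtEq 𝕄 w i j)
  LtEq? i j = PR? i ⋖ j ⊎-dec PR? i ≐ j

  Holds? : ∀ a i → Dec (Holds 𝕄 w a i)
  Holds? a i with symAt 𝕄 w i
  ... | nothing = no λ ()
  ... | just # = no λ ()
  ... | just ⟨ σ ⟩ = map′ (λ a∈σ → σ , refl , a∈σ) (λ { (_ , refl , a∈σ) → a∈σ }) (a ∈? σ)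

  DStep? : ∀ j p q → Dec (DStep 𝕄 w j p q)
  DStep? j p q =
    (χ? p q ×-dec LtEq? p q ×-dec (q ≤? j) ×-dec all≤? (λ h → χ? p h →-dec (LtEq? p h →-dec (h ≤? q))) j)
    ⊎-dec (all≤? (λ h → χ? p h →-dec ¬? (LtEq? p h)) j ×-dec (q ≟ suc p) ×-dec LtEq? p (suc p))

  DStep-< : ∀ {j p q} → DStep 𝕄 w j p q → p < q
  DStep-< (inj₁ ((_ , c) , _)) = chain-< c
  DStep-< (inj₂ (_ , refl , _)) = n<1+n _

  DStep-bound : ∀ {j p q} → DStep 𝕄 w j p q → q < N
  DStep-bound (inj₁ ((_ , c) , _)) = chain-bound c
  DStep-bound {p = p} (inj₂ (_ , refl , p≤1+p)) = LtEq-bound {p} p≤1+p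

  UStep? : ∀ h p q → Dec (UStep 𝕄 w h p q)
  UStep? h p q = (p <? q) ×-dec χ? h q ×-dec PR? h ⋖ q ×-dec allBetween? (λ m → ¬? (χ? h m)) p q

  UStep-bound : ∀ {h p q} → UStep 𝕄 w h p q → q < N
  UStep-bound (_ , (_ , c) , _) = chain-bound c

  private
    path-end-bound : ∀ {S P i j} → (∀ {p} → S p j → j < N) → PathU S P i j → j < suc (i + N)
    path-end-bound {i = i} bound path with PathU-last path
    ... | inj₁ refl = s≤s (m≤m+n i N)
    ... | inj₂ (_ , s) = m<n⇒m<1+n (<-≤-trans (bound s) (m≤n+m N i))

  -- Every quantifier ranges below N, or below i + N for the end of a path starting at i.
  PSat? : ∀ i θ → Dec (PSat 𝕄 w i θ)
  PSat? i (atom a) = Holds? a i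
  PSat? i ttrue = yes tt
  PSat? i (neg θ) = ¬? (PSat? i θ)
  PSat? i (conj θ η) = PSat? i θ ×-dec PSat? i η
  PSat? i (disj θ η) = PSat? i θ ⊎-dec PSat? i η
  PSat? i (nextD θ) = LtEq? i (suc i) ×-dec PSat? (suc i) θ
  PSat? zero (prevD θ) = no λ ()
  PSat? (suc i) (prevD θ) = LtEq? i (suc i) ×-dec PSat? i θ
  PSat? i (nextDχ θ) = bounded-∃? N (λ { j (_ , (_ , c) , _) → chain-bound c })
    λ j → (i <? j) ×-dec χ? i j ×-dec LtEq? i j ×-dec PSat? j θ
  PSat? i (prevDχ θ) = bounded-∃? i (λ _ → proj₁)
    λ j → (j <? i) ×-dec χ? j i ×-dec LtEq? j i ×-dec PSat? j θ
  PSat? i (untilDχ θ η) = bounded-∃? (suc (i + N)) (λ { j (_ , path , _) → path-end-bound DStep-bound path })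
    λ j → (i ≤? j) ×-dec PathDecision.PathU? (DStep? j) (λ x → PSat? x θ) DStep-< i j ×-dec PSat? j η
  PSat? i (sinceDχ θ η) = bounded-∃? (suc i) (λ _ (j≤i , _) → s≤s j≤i)
    λ j → (j ≤? i) ×-dec PathDecision.PathS? (DStep? i) (λ x → PSat? x θ) DStep-< j i ×-dec PSat? j η
  PSat? i (nextUH θ) = bounded-∃? i (λ _ (_ , h<i , _) → h<i) λ h →
    bounded-∃? N (λ { j (_ , _ , _ , _ , (_ , c) , _) → chain-bound c }) λ j →
      (h <? i) ×-dec χ? h i ×-dec PR? h ⋖ i ×-dec (i <? j) ×-dec χ? h j ×-dec PR? h ⋖ j ×-dec
      allBetween? (λ m → ¬? (χ? h m ×-dec PR? h ⋖ m)) i j ×-dec PSat? j θ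
  PSat? i (prevUH θ) = bounded-∃? i (λ _ (_ , h<i , _) → h<i) λ h →
    bounded-∃? i (λ _ (_ , _ , _ , j<i , _) → j<i) λ j →
      (h <? i) ×-dec χ? h i ×-dec PR? h ⋖ i ×-dec (j <? i) ×-dec χ? h j ×-dec PR? h ⋖ j ×-dec
      allBetween? (λ m → ¬? (χ? h m ×-dec PR? h ⋖ m)) j i ×-dec PSat? j θ
  PSat? i (untilUH θ η) = bounded-∃? i (λ _ (_ , _ , h<i , _) → h<i) λ h →
    bounded-∃? (suc (i + N)) (λ _ (_ , _ , _ , _ , path , _) → path-end-bound UStep-bound path) λ j →
      (i ≤? j) ×-dec (h <? i) ×-dec χ? h i ×-dec PR? h ⋖ i ×-dec
      PathDecision.PathU? (UStep? h) (λ x → PSat? x θ) proj₁ i j ×-dec PSat? j η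
  PSat? i (sinceUH θ η) = bounded-∃? i (λ _ (_ , j≤i , h<j , _) → <-≤-trans h<j j≤i) λ h →
    bounded-∃? (suc i) (λ _ (j≤i , _) → s≤s j≤i) λ j →
      (j ≤? i) ×-dec (h <? j) ×-dec χ? h j ×-dec PR? h ⋖ j ×-dec
      PathDecision.PathS? (UStep? h) (λ x → PSat? x θ) proj₁ j i ×-dec PSat? j η
  PSat? i (nextχ π θ) = bounded-∃? N (λ _ ((_ , c) , _) → chain-bound c) λ j →
    χ? i j ×-dec PR? i π j ×-dec PSat? j θ
  PSat? i (prevχ π θ) = bounded-∃? i (λ _ → proj₁) λ j →
    (j <? i) ×-dec χ? j i ×-dec PR? j π i ×-dec PSat? j θ
  PSat? i (nextLt θ) = PR? i ⋖ (suc i) ×-dec PSat? (suc i) θ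
  PSat? zero (prevLt θ) = no λ ()
  PSat? (suc i) (prevLt θ) = PR? i ⋖ (suc i) ×-dec PSat? i θ

  PSat-stable : ∀ i θ → ¬ ¬ PSat 𝕄 w i θ → PSat 𝕄 w i θ
  PSat-stable i θ = decidable-stable (PSat? i θ)

  -- The tree τ(w)

  ChildCond? : ∀ p j → Dec (ChildCond 𝕄 w p j)
  ChildCond? p j = χ? p j ×-dec LtEq? p j

  module ChildRank (p : ℕ) = Counting (ChildCond? p)
  open ChildRank using (count)

  countBelow⇒≡count : ∀ {p j c} → CountBelow 𝕄 w p j c → c ≡ count p j
  countBelow⇒≡count {p} (L , L-unique , L-members , refl) = ChildRank.count-unique p L-unique L-members

  countBelow-count : ∀ p j → CountBelow 𝕄 w p j (count p j)
  countBelow-count p j = ChildRank.below p j , ChildRank.below-unique p j , ChildRank.∈-below p j , refl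

  ChildAt : ℕ → ℕ → ℕ → Set
  ChildAt p a x = (x ≡ 0 × a ≡ suc p × LtEq 𝕄 w p (suc p)) ⊎ (x ≡ suc (count p a) × ChildCond 𝕄 w p a)

  []≢∷ʳ : ∀ (r : List ℕ) x → [] ≢ r ++ [ x ]
  []≢∷ʳ [] x ()
  []≢∷ʳ (_ ∷ _) x ()

  Tau-parent : ∀ {a s r x} → Tau 𝕄 w a s → s ≡ r ++ [ x ] → ∃ λ p → Tau 𝕄 w p r × ChildAt p a x
  Tau-parent root eq = ⊥-elim ([]≢∷ʳ _ _ eq)
  Tau-parent (eqChild t p≐1+p) eq with refl , refl ← List.∷ʳ-injective _ _ eq =
    _ , t , inj₁ (refl , refl , inj₂ p≐1+p)
  Tau-parent (ltFirst t p⋖1+p) eq with refl , refl ← List.∷ʳ-injective _ _ eq =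
    _ , t , inj₁ (refl , refl , inj₁ p⋖1+p)
  Tau-parent (ltChi t _ cc below) eq with refl , refl ← List.∷ʳ-injective _ _ eq =
    _ , t , inj₂ (cong suc (countBelow⇒≡count below) , cc)

  Tau-root : ∀ {a s} → Tau 𝕄 w a s → s ≡ [] → a ≡ 0
  Tau-root root _ = refl
  Tau-root (eqChild _ _) eq = ⊥-elim ([]≢∷ʳ _ _ (sym eq))
  Tau-root (ltFirst _ _) eq = ⊥-elim ([]≢∷ʳ _ _ (sym eq))
  Tau-root (ltChi _ _ _ _) eq = ⊥-elim ([]≢∷ʳ _ _ (sym eq))

  Tau-injective : ∀ {a b s} → Tau 𝕄 w a s → Tau 𝕄 w b s → a ≡ b
  Tau-injective root t = sym (Tau-root t refl)
  Tau-injective (eqChild t _) t′ with Tau-parent t′ refl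
  ... | _ , t″ , inj₁ (_ , refl , _) = cong suc (Tau-injective t t″)
  ... | _ , _ , inj₂ (() , _)
  Tau-injective (ltFirst t _) t′ with Tau-parent t′ refl
  ... | _ , t″ , inj₁ (_ , refl , _) = cong suc (Tau-injective t t″)
  ... | _ , _ , inj₂ (() , _)
  Tau-injective (ltChi t _ cc below) t′ with Tau-parent t′ refl
  ... | _ , _ , inj₁ (() , _)
  ... | _ , t″ , inj₂ (eq , cc′) with refl ← Tau-injective t t″ =
    ChildRank.count-injective _ cc cc′ (trans (sym (countBelow⇒≡count below)) (suc-injective eq))

  Tau-χ-child : ∀ {p r a} → Tau 𝕄 w p r → ChildCond 𝕄 w p a → Tau 𝕄 w a (r ++ [ suc (count p a) ])
  Tau-χ-child {p} {a = a} t cc@((_ , c) , _) = ltChi t (prec (chain-first-⋖ c)) cc (countBelow-count p a)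

  Tau-later-child : ∀ {p r b h} → Tau 𝕄 w p r → Tau 𝕄 w b (r ++ [ h ]) → 0 < h →
                    h ≡ suc (count p b) × ChildCond 𝕄 w p b
  Tau-later-child t t′ 0<h with Tau-parent t′ refl
  ... | _ , t″ , kind with refl ← Tau-injective t″ t with kind
  ...   | inj₁ (refl , _) = contradiction 0<h (<-irrefl refl)
  ...   | inj₂ later = later

  Node-left-sibling : ∀ {b r h h′} → Tau 𝕄 w b (r ++ [ h′ ]) → h ≤ h′ → Node 𝕄 w (r ++ [ h ])
  Node-left-sibling {b} t h≤h′ with Tau-parent t refl
  Node-left-sibling {b} t z≤n | _ , _ , inj₁ (refl , _) = b , t
  Node-left-sibling {b} t z≤n | p , tp , inj₂ (refl , (_ , c) , _) =
    suc p , ltFirst tp (prec (chain-first-⋖ c))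
  Node-left-sibling {b} t (s≤s c≤count) | p , tp , inj₂ (refl , _) with m≤n⇒m<n∨m≡n c≤count
  ... | inj₂ refl = b , t
  ... | inj₁ c<count with ChildRank.count-surjective p b c<count
  ...   | a , _ , cc , refl = a , Tau-χ-child tp cc

  R⁺⇒-same-parent : ∀ {s u} → R⁺ 𝕄 w ⇒ s u →
                    ∃₂ λ r h → ∃ λ h′ → s ≡ r ++ [ h ] × u ≡ r ++ [ h′ ] × h < h′
  R⁺⇒-same-parent [ _ , _ , r , h , refl , refl ]⁺ = r , h , suc h , refl , refl , ≤-refl
  R⁺⇒-same-parent ((_ , _ , r , h , refl , refl) ∷⁺ rest) with R⁺⇒-same-parent rest
  ... | r′ , _ , _ , eq , refl , lt with refl , refl ← List.∷ʳ-injective r r′ eq =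
    r , h , _ , refl , refl , <-trans (n<1+n h) lt

  R⁺⇒-target : ∀ {s u} → R⁺ 𝕄 w ⇒ s u → Node 𝕄 w u
  R⁺⇒-target [ _ , node , _ ]⁺ = node
  R⁺⇒-target (_ ∷⁺ rest) = R⁺⇒-target rest

  R⁺⇒-siblings : ∀ {r h h′} → Node 𝕄 w (r ++ [ h ]) → Node 𝕄 w (r ++ [ h′ ]) → h < h′ →
                 R⁺ 𝕄 w ⇒ (r ++ [ h ]) (r ++ [ h′ ])
  R⁺⇒-siblings {r} {h} {suc h″} node node′ h<1+h″ with m<1+n⇒m<n∨m≡n h<1+h″
  ... | inj₂ refl = [ node , node′ , r , h , refl , refl ]⁺
  ... | inj₁ h<h″ = R⁺⇒-siblings node middle h<h″ ∷ʳ (middle , node′ , r , h″ , refl , refl)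
    where
      middle : Node 𝕄 w (r ++ [ h″ ])
      middle = Node-left-sibling (proj₂ node′) (n≤1+n h″)

  Tau-root-or-child : ∀ {a s} → Tau 𝕄 w a s →
                      (a ≡ 0 × s ≡ []) ⊎ ∃₂ λ r x → s ≡ r ++ [ x ] × ∃ λ p → Tau 𝕄 w p r × ChildAt p a x
  Tau-root-or-child root = inj₁ (refl , refl)
  Tau-root-or-child t@(eqChild _ _) = inj₂ (_ , _ , refl , Tau-parent t refl)
  Tau-root-or-child t@(ltFirst _ _) = inj₂ (_ , _ , refl , Tau-parent t refl)
  Tau-root-or-child t@(ltChi _ _ _ _) = inj₂ (_ , _ , refl , Tau-parent t refl)

  SiblingUntilVia : Prec → (ℕ → Set) → (ℕ → Set) → ℕ → ℕ → Set
  SiblingUntilVia π Φ Ψ p i = ∃ λ t → χʷ p t × PR 𝕄 w p π t × i < t × Ψ t ×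
    (∀ m → ChildCond 𝕄 w p m → i < m → m < t → Φ m)

  SiblingUntil : (ℕ → Set) → (ℕ → Set) → ℕ → ℕ → Set
  SiblingUntil Φ Ψ p i = ∃ λ t → ChildCond 𝕄 w p t × i < t × Ψ t ×
    (∀ m → ChildCond 𝕄 w p m → i < m → m < t → Φ m)

  SiblingUntil-split : ∀ {Φ Ψ p i} →
                       SiblingUntil Φ Ψ p i ⇔ (SiblingUntilVia ⋖ Φ Ψ p i ⊎ SiblingUntilVia ≐ Φ Ψ p i)
  SiblingUntil-split = mk⇔
    (λ { (t , (χt , inj₁ p⋖t) , rest) → inj₁ (t , χt , p⋖t , rest)
       ; (t , (χt , inj₂ p≐t) , rest) → inj₂ (t , χt , p≐t , rest) })
    (λ { (inj₁ (t , χt , p⋖t , rest)) → t , (χt , inj₁ p⋖t) , rest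
       ; (inj₂ (t , χt , p≐t , rest)) → t , (χt , inj₂ p≐t) , rest })

  ChildAt-<⇒ : ∀ {p i x m} → ChildAt p i x → ChildCond 𝕄 w p m → x < suc (count p m) → i < m
  ChildAt-<⇒ (inj₁ (refl , refl , _)) ((1+p<m , _) , _) _ = 1+p<m
  ChildAt-<⇒ {p} (inj₂ (refl , _)) _ lt = ChildRank.count-reflects-< p (m<1+n⇒m≤n lt)

  ChildAt-<⇐ : ∀ {p i x m} → ChildAt p i x → ChildCond 𝕄 w p m → i < m → x < suc (count p m)
  ChildAt-<⇐ (inj₁ (refl , refl , _)) _ _ = s≤s z≤n
  ChildAt-<⇐ {p} (inj₂ (refl , cc)) _ i<m = s≤s (ChildRank.count-strict p cc i<m)

  R⁺⇒-index-< : ∀ {r h h′} → R⁺ 𝕄 w ⇒ (r ++ [ h ]) (r ++ [ h′ ]) → h < h′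
  R⁺⇒-index-< path with R⁺⇒-same-parent path
  ... | _ , _ , _ , eq , eq′ , lt with List.∷ʳ-injective _ _ eq | List.∷ʳ-injective _ _ eq′
  ... | refl , refl | _ , refl = lt

  R⁺⇒-later-sibling : ∀ {p r i x s} → Tau 𝕄 w p r → ChildAt p i x → R⁺ 𝕄 w ⇒ (r ++ [ x ]) s →
                      ∃ λ m → ChildCond 𝕄 w p m × i < m × Tau 𝕄 w m s × s ≡ r ++ [ suc (count p m) ]
  R⁺⇒-later-sibling tp child path with R⁺⇒-same-parent path | R⁺⇒-target path
  ... | _ , _ , _ , eq , refl , x<h | m , tm with List.∷ʳ-injective _ _ eq
  ... | refl , refl with Tau-later-child tp tm (≤-<-trans z≤n x<h)
  ... | refl , cc = m , cc , ChildAt-<⇒ child cc x<h , tm , refl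

  XSat-⇒-root : ∀ {φ ψ} → ¬ XSat 𝕄 w [] (until ⇒ φ ψ)
  XSat-⇒-root (_ , path , _) with R⁺⇒-same-parent path
  ... | r , h , _ , eq , _ = []≢∷ʳ r h eq

  module _ (φ ψ : XF k) (Φ Ψ : ℕ → Set)
           (φ⇔Φ : ∀ i s → Tau 𝕄 w i s → XSat 𝕄 w s φ ⇔ Φ i)
           (ψ⇔Ψ : ∀ i s → Tau 𝕄 w i s → XSat 𝕄 w s ψ ⇔ Ψ i) where

    XSat-⇒⇔SiblingUntil : ∀ {p r i x} → Tau 𝕄 w p r → Tau 𝕄 w i (r ++ [ x ]) → ChildAt p i x →
                           XSat 𝕄 w (r ++ [ x ]) (until ⇒ φ ψ) ⇔ SiblingUntil Φ Ψ p i
    XSat-⇒⇔SiblingUntil {p} {r} {i} {x} tp ti child = mk⇔ to from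
      where
        to : XSat 𝕄 w (r ++ [ x ]) (until ⇒ φ ψ) → SiblingUntil Φ Ψ p i
        to (_ , path , ψt , between) with R⁺⇒-later-sibling tp child path
        ... | b , cc , i<b , tb , refl = b , cc , i<b , Equivalence.to (ψ⇔Ψ b _ tb) ψt , Φ-between
          where
            Φ-between : ∀ m → ChildCond 𝕄 w p m → i < m → m < b → Φ m
            Φ-between m cc′ i<m m<b = Equivalence.to (φ⇔Φ m _ tm)
              (between _ (R⁺⇒-siblings (i , ti) (m , tm) (ChildAt-<⇐ child cc′ i<m))
                         (R⁺⇒-siblings (m , tm) (b , tb) (s≤s (ChildRank.count-strict p cc′ m<b))))
              where
                tm : Tau 𝕄 w m (r ++ [ suc (count p m) ])
                tm = Tau-χ-child tp cc′

        from : SiblingUntil Φ Ψ p i → XSat 𝕄 w (r ++ [ x ]) (until ⇒ φ ψ)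
        from (b , cc , i<b , Ψb , Φ-between) =
          _ , R⁺⇒-siblings (i , ti) (b , tb) (ChildAt-<⇐ child cc i<b) , Equivalence.from (ψ⇔Ψ b _ tb) Ψb ,
          φ-between
          where
            tb : Tau 𝕄 w b (r ++ [ suc (count p b) ])
            tb = Tau-χ-child tp cc
            φ-between : ∀ s → R⁺ 𝕄 w ⇒ (r ++ [ x ]) s → R⁺ 𝕄 w ⇒ s (r ++ [ suc (count p b) ]) → XSat 𝕄 w s φ
            φ-between s path₁ path₂ with R⁺⇒-later-sibling tp child path₁
            ... | m , cc′ , i<m , tm , refl = Equivalence.from (φ⇔Φ m _ tm)
              (Φ-between m cc′ i<m (ChildRank.count-reflects-< p (m<1+n⇒m≤n (R⁺⇒-index-< path₂))))

  -- Upward hierarchical paths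

  ⋖-child<≐-child : ∀ {p x t} → Ch p x → p ⋖ʷ x → Ch p t → p ≐ʷ t → x < t
  ⋖-child<≐-child {p} {x} {t} cx p⋖x ct p≐t with <-cmp x t
  ... | tri< x<t _ _ = x<t
  ... | tri≈ _ refl _ = ⊥-elim (⋖⇒¬≐ {p} {x} (pr p⋖x) (pr p≐t))
  ... | tri> _ _ t<x = ⊥-elim (⋖⇒¬≐ (shared-left-⋖ ct cx t<x) (pr p≐t))

  ⋖-before : ∀ {h x t} → Ch h t → x < t → χʷ h x → h ⋖ʷ x
  ⋖-before ct x<t (_ , cx) = prec (shared-left-⋖ cx ct x<t)

  UHP-end : ∀ {h P a b} → χʷ h a → h ⋖ʷ a → PathU (UStep 𝕄 w h) P a b → χʷ h b × h ⋖ʷ b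
  UHP-end χa h⋖a path with PathU-last path
  ... | inj₁ refl = χa , h⋖a
  ... | inj₂ (_ , _ , χb , h⋖b , _) = χb , h⋖b

  UHPˢ-end : ∀ {h P a b} → χʷ h a → h ⋖ʷ a → PathS (UStep 𝕄 w h) P a b → χʷ h b × h ⋖ʷ b
  UHPˢ-end χa h⋖a path with PathS-last path
  ... | inj₁ refl = χa , h⋖a
  ... | inj₂ (_ , _ , χb , h⋖b , _) = χb , h⋖b

  UHP-covers : ∀ {h P a b m} → PathU (UStep 𝕄 w h) P a b → a ≤ m → m < b → χʷ h m → P m
  UHP-covers done a≤m m<a = contradiction a≤m (<⇒≱ m<a)
  UHP-covers {m = m} (step {q = q} Pa (a<q , _ , _ , none-between) rest) a≤m m<b χm with m≤n⇒m<n∨m≡n a≤m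
  ... | inj₂ refl = Pa
  ... | inj₁ a<m with <-cmp m q
  ...   | tri< m<q _ _ = contradiction χm (none-between m a<m m<q)
  ...   | tri≈ _ refl _ = UHP-covers rest ≤-refl m<b χm
  ...   | tri> _ _ q<m = UHP-covers rest (<⇒≤ q<m) m<b χm

  module χ-Search (h : ℕ) = BoundedSearch (χ? h)

  ⋖-up-to : ∀ {h x t} → Ch h t → h ⋖ʷ t → x ≤ t → χʷ h x → h ⋖ʷ x
  ⋖-up-to ct h⋖t x≤t χx with m≤n⇒m<n∨m≡n x≤t
  ... | inj₁ x<t = ⋖-before ct x<t χx
  ... | inj₂ refl = h⋖t

  private
    uhp-path : ∀ {h} {P : ℕ → Set} d {a b} → b ≤ a + d → a ≤ b → χʷ h a → χʷ h b →
               (∀ x → a ≤ x → x ≤ b → χʷ h x → h ⋖ʷ x) → (∀ x → a ≤ x → x < b → χʷ h x → P x) →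
               PathU (UStep 𝕄 w h) P a b
    uhp-path zero b≤a+0 a≤b _ _ _ _ with ≤-antisym a≤b (≤-trans b≤a+0 (≤-reflexive (+-identityʳ _)))
    ... | refl = done
    uhp-path {h} (suc d) {a} {b} b≤ a≤b χa χb ⋖-all P-all with m≤n⇒m<n∨m≡n a≤b
    ... | inj₂ refl = done
    ... | inj₁ a<b with χ-Search.firstAbove h a<b χb
    ...   | x , x≤b , a<x , χx , none-between =
      step (P-all a ≤-refl a<b χa) (a<x , χx , ⋖-all x (<⇒≤ a<x) x≤b χx , none-between)
        (uhp-path d (shift-bound a<x b≤) x≤b χx χb
          (λ y x≤y → ⋖-all y (≤-trans (<⇒≤ a<x) x≤y)) (λ y x≤y → P-all y (≤-trans (<⇒≤ a<x) x≤y)))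

    uhpˢ-path : ∀ {h} {P : ℕ → Set} d {a b} → b ≤ a + d → a ≤ b → χʷ h a → χʷ h b →
                (∀ x → a ≤ x → x ≤ b → χʷ h x → h ⋖ʷ x) → (∀ x → a < x → x ≤ b → χʷ h x → P x) →
                PathS (UStep 𝕄 w h) P a b
    uhpˢ-path zero b≤a+0 a≤b _ _ _ _ with ≤-antisym a≤b (≤-trans b≤a+0 (≤-reflexive (+-identityʳ _)))
    ... | refl = done
    uhpˢ-path {h} (suc d) {a} {b} b≤ a≤b χa χb ⋖-all P-all with m≤n⇒m<n∨m≡n a≤b
    ... | inj₂ refl = done
    ... | inj₁ a<b with χ-Search.firstAbove h a<b χb
    ...   | x , x≤b , a<x , χx , none-between =
      step (a<x , χx , ⋖-all x (<⇒≤ a<x) x≤b χx , none-between) (P-all x a<x x≤b χx)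
        (uhpˢ-path d (shift-bound a<x b≤) x≤b χx χb
          (λ y x≤y → ⋖-all y (≤-trans (<⇒≤ a<x) x≤y)) (λ y x<y → P-all y (<-trans a<x x<y)))

  UHP-path : ∀ {h} {P : ℕ → Set} {a b} → a ≤ b → χʷ h a → χʷ h b →
             (∀ x → a ≤ x → x ≤ b → χʷ h x → h ⋖ʷ x) → (∀ x → a ≤ x → x < b → χʷ h x → P x) →
             PathU (UStep 𝕄 w h) P a b
  UHP-path {a = a} {b} = uhp-path b (m≤n+m b a)

  UHPˢ-path : ∀ {h} {P : ℕ → Set} {a b} → a ≤ b → χʷ h a → χʷ h b →
              (∀ x → a ≤ x → x ≤ b → χʷ h x → h ⋖ʷ x) → (∀ x → a < x → x ≤ b → χʷ h x → P x) →
              PathS (UStep 𝕄 w h) P a b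
  UHPˢ-path {a = a} {b} = uhpˢ-path b (m≤n+m b a)

  -- The translation of ⇒

  Sat : PF k → ℕ → Set
  Sat θ i = PSat 𝕄 w i θ

  nextUH-untilUH⇔SiblingUntilVia⋖ : ∀ {p i θ η} → χʷ p i → p ⋖ʷ i →
    Sat (nextUH (untilUH θ η)) i ⇔ SiblingUntilVia ⋖ (Sat θ) (Sat η) p i
  nextUH-untilUH⇔SiblingUntilVia⋖ {p} {i} {θ} {η} χi@(1+p<i , ci) p⋖i = mk⇔ to from
    where
      to : Sat (nextUH (untilUH θ η)) i → SiblingUntilVia ⋖ (Sat θ) (Sat η) p i
      to (h , j , _ , (_ , ci′) , h⋖i , i<j , χj@(_ , cj) , h⋖j , none-between ,
          (h′ , t , j≤t , _ , (_ , cj′) , h′⋖j , path , ηt))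
        with LtEq-parent-unique ci′ (inj₁ h⋖i) ci (inj₁ p⋖i)
      ... | refl with LtEq-parent-unique cj′ (inj₁ h′⋖j) cj (inj₁ h⋖j)
      ... | refl with UHP-end χj h⋖j path
      ... | χt@(_ , ct) , p⋖t = t , χt , p⋖t , <-≤-trans i<j j≤t , ηt , θ-between
        where
          θ-between : ∀ m → ChildCond 𝕄 w p m → i < m → m < t → Sat θ m
          θ-between m (χm , _) i<m m<t with <-cmp m j
          ... | tri< m<j _ _ = contradiction (χm , ⋖-before ct m<t χm) (none-between m i<m m<j)
          ... | tri≈ _ refl _ = UHP-covers path ≤-refl m<t χm
          ... | tri> _ _ j<m = UHP-covers path (<⇒≤ j<m) m<t χm

      from : SiblingUntilVia ⋖ (Sat θ) (Sat η) p i → Sat (nextUH (untilUH θ η)) i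
      from (t , χt@(_ , ct) , p⋖t , i<t , ηt , θ-between) with χ-Search.firstAbove p i<t χt
      ... | x , x≤t , i<x , χx , none-between =
        p , x , <-trans (n<1+n p) 1+p<i , χi , p⋖i , i<x , χx , p⋖x ,
        (λ m i<m m<x → none-between m i<m m<x ∘ proj₁) ,
        (p , t , x≤t , <-trans (n<1+n p) (proj₁ χx) , χx , p⋖x , path , ηt)
        where
          p⋖x : p ⋖ʷ x
          p⋖x = ⋖-up-to ct p⋖t x≤t χx
          path : PathU (UStep 𝕄 w p) (Sat θ) x t
          path = UHP-path x≤t χx χt (λ y _ → ⋖-up-to ct p⋖t)
            λ y x≤y y<t χy → θ-between y (χy , inj₁ (⋖-before ct y<t χy)) (<-≤-trans i<x x≤y) y<t

  prevUH-sinceUH-true⇔earlier-child : ∀ {p t η} → χʷ p t → p ⋖ʷ t →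
    Sat (prevUH (sinceUH ttrue η)) t ⇔ (∃ λ m → χʷ p m × m < t × Sat η m)
  prevUH-sinceUH-true⇔earlier-child {p} {t} {η} χt@(1+p<t , ct) p⋖t = mk⇔ to from
    where
      to : Sat (prevUH (sinceUH ttrue η)) t → ∃ λ m → χʷ p m × m < t × Sat η m
      to (h , j , _ , (_ , ct′) , h⋖t , j<t , χj@(_ , cj) , h⋖j , _ ,
          (h′ , m , m≤j , _ , χ′m , h′⋖m , path , ηm))
        with LtEq-parent-unique ct′ (inj₁ h⋖t) ct (inj₁ p⋖t)
      ... | refl with UHPˢ-end χ′m h′⋖m path
      ... | (_ , cj′) , h′⋖j with LtEq-parent-unique cj′ (inj₁ h′⋖j) cj (inj₁ h⋖j)
      ... | refl = m , χ′m , ≤-<-trans m≤j j<t , ηm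

      from : (∃ λ m → χʷ p m × m < t × Sat η m) → Sat (prevUH (sinceUH ttrue η)) t
      from (m , χm , m<t , ηm) with χ-Search.lastBelow p m<t χm
      ... | j , m≤j , j<t , χj , none-between =
        p , j , <-trans (n<1+n p) 1+p<t , χt , p⋖t , j<t , χj , ⋖-before ct j<t χj ,
        (λ y j<y y<t (χy , _) → none-between y j<y y<t χy) ,
        (p , m , m≤j , <-trans (n<1+n p) (proj₁ χm) , χm , ⋖-before ct m<t χm ,
         UHPˢ-path m≤j χm χj (λ y _ y≤j → ⋖-before ct (≤-<-trans y≤j j<t)) (λ _ _ _ _ → tt) , ηm)

  module _ (φ′ ψ′ : PF k) where

    -- The disjuncts of ι(⇒(φ,ψ)) for φ′ = ι φ and ψ′ = ι ψ: τ(i) is a χ-child (D₁, D₂) or the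
    -- first child (D₃, D₄) of its parent, and the witness sibling is a ⋖-child (D₁, D₃) or a
    -- ≐-child (D₂, D₄).
    D₁ D₂ D₃ D₄ : PF k
    D₁ = nextUH (untilUH φ′ ψ′)
    D₂ = neg (nextUH (untilUH ttrue (neg φ′))) ∧' prevχ ⋖ (nextχ ≐ ψ′)
    D₃ = prevLt (nextχ ⋖ (ψ′ ∧' neg (prevUH (sinceUH ttrue (neg φ′)))))
    D₄ = prevLt (nextχ ≐ ψ′ ∧' neg (nextχ ⋖ (neg φ′)))

    private
      Φ Ψ : ℕ → Set
      Φ = Sat φ′
      Ψ = Sat ψ′

    D₂⇔SiblingUntilVia≐ : ∀ {p i} → χʷ p i → p ⋖ʷ i → Sat D₂ i ⇔ SiblingUntilVia ≐ Φ Ψ p i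
    D₂⇔SiblingUntilVia≐ {p} {i} χi@(1+p<i , ci) p⋖i = mk⇔ to from
      where
        open Equivalence (nextUH-untilUH⇔SiblingUntilVia⋖ {θ = ttrue} {η = neg φ′} χi p⋖i)
          renaming (to to later-¬Φ; from to from-later-¬Φ)

        to : Sat D₂ i → SiblingUntilVia ≐ Φ Ψ p i
        to (no-later-¬Φ , _ , _ , (_ , ci′) , j⋖i , t , χt@(_ , ct) , j≐t , Ψt)
          with LtEq-parent-unique ci′ (inj₁ j⋖i) ci (inj₁ p⋖i)
        ... | refl = t , χt , j≐t , ⋖-child<≐-child ci p⋖i ct j≐t , Ψt , Φ-between
          where
            Φ-between : ∀ m → ChildCond 𝕄 w p m → i < m → m < t → Φ m
            Φ-between m (χm , _) i<m m<t = PSat-stable m φ′ λ ¬Φm →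
              no-later-¬Φ (from-later-¬Φ (m , χm , ⋖-before ct m<t χm , i<m , ¬Φm , λ _ _ _ _ → tt))

        from : SiblingUntilVia ≐ Φ Ψ p i → Sat D₂ i
        from (t , χt@(_ , ct) , p≐t , _ , Ψt , Φ-between) =
          no-later-¬Φ , p , <-trans (n<1+n p) 1+p<i , χi , p⋖i , t , χt , p≐t , Ψt
          where
            no-later-¬Φ : ¬ Sat (nextUH (untilUH ttrue (neg φ′))) i
            no-later-¬Φ later with later-¬Φ later
            ... | m , χm@(_ , cm) , p⋖m , i<m , ¬Φm , _ =
              ¬Φm (Φ-between m (χm , inj₁ p⋖m) i<m (⋖-child<≐-child cm p⋖m ct p≐t))

    D₃⇔SiblingUntilVia⋖ : ∀ {p} → p ⋖ʷ suc p → Sat D₃ (suc p) ⇔ SiblingUntilVia ⋖ Φ Ψ p (suc p)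
    D₃⇔SiblingUntilVia⋖ {p} p⋖1+p = mk⇔ to from
      where
        to : Sat D₃ (suc p) → SiblingUntilVia ⋖ Φ Ψ p (suc p)
        to (_ , t , χt@(1+p<t , ct) , p⋖t , Ψt , no-earlier-¬Φ) = t , χt , p⋖t , 1+p<t , Ψt , Φ-between
          where
            Φ-between : ∀ m → ChildCond 𝕄 w p m → suc p < m → m < t → Φ m
            Φ-between m (χm , _) _ m<t = PSat-stable m φ′ λ ¬Φm →
              no-earlier-¬Φ (Equivalence.from (prevUH-sinceUH-true⇔earlier-child χt p⋖t) (m , χm , m<t , ¬Φm))

        from : SiblingUntilVia ⋖ Φ Ψ p (suc p) → Sat D₃ (suc p)
        from (t , χt@(_ , ct) , p⋖t , _ , Ψt , Φ-between) = p⋖1+p , t , χt , p⋖t , Ψt , no-earlier-¬Φ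
          where
            no-earlier-¬Φ : ¬ Sat (prevUH (sinceUH ttrue (neg φ′))) t
            no-earlier-¬Φ earlier with Equivalence.to (prevUH-sinceUH-true⇔earlier-child χt p⋖t) earlier
            ... | m , χm , m<t , ¬Φm = ¬Φm (Φ-between m (χm , inj₁ (⋖-before ct m<t χm)) (proj₁ χm) m<t)

    D₄⇔SiblingUntilVia≐ : ∀ {p} → p ⋖ʷ suc p → Sat D₄ (suc p) ⇔ SiblingUntilVia ≐ Φ Ψ p (suc p)
    D₄⇔SiblingUntilVia≐ {p} p⋖1+p = mk⇔ to from
      where
        to : Sat D₄ (suc p) → SiblingUntilVia ≐ Φ Ψ p (suc p)
        to (_ , (t , χt@(1+p<t , ct) , p≐t , Ψt) , no-⋖-¬Φ) = t , χt , p≐t , 1+p<t , Ψt , Φ-between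
          where
            Φ-between : ∀ m → ChildCond 𝕄 w p m → suc p < m → m < t → Φ m
            Φ-between m (χm , _) _ m<t = PSat-stable m φ′ λ ¬Φm → no-⋖-¬Φ (m , χm , ⋖-before ct m<t χm , ¬Φm)

        from : SiblingUntilVia ≐ Φ Ψ p (suc p) → Sat D₄ (suc p)
        from (t , χt@(_ , ct) , p≐t , _ , Ψt , Φ-between) = p⋖1+p , (t , χt , p≐t , Ψt) , no-⋖-¬Φ
          where
            no-⋖-¬Φ : ¬ Sat (nextχ ⋖ (neg φ′)) p
            no-⋖-¬Φ (x , χx@(1+p<x , cx) , p⋖x , ¬Φx) =
              ¬Φx (Φ-between x (χx , inj₁ p⋖x) 1+p<x (⋖-child<≐-child cx p⋖x ct p≐t))

    ⇒-translation : PF k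
    ⇒-translation = D₁ ∨' D₂ ∨' D₃ ∨' D₄

    private
      SiblingUntilVia⋖⊎≐ : ℕ → ℕ → Set
      SiblingUntilVia⋖⊎≐ p i = SiblingUntilVia ⋖ Φ Ψ p i ⊎ SiblingUntilVia ≐ Φ Ψ p i

      prevLt-at-right-context : ∀ {h i θ} → Ch h i → ¬ Sat (prevLt θ) i
      prevLt-at-right-context {i = suc i} c (i⋖1+i , _) = ⋖⇒¬⋗ (pr i⋖1+i) (chain-last-⋗ c)

    ⇒-translation-root : ¬ Sat ⇒-translation 0
    ⇒-translation-root (inj₁ (_ , _ , () , _))
    ⇒-translation-root (inj₂ (inj₁ (_ , _ , () , _)))
    ⇒-translation-root (inj₂ (inj₂ (inj₁ ())))
    ⇒-translation-root (inj₂ (inj₂ (inj₂ ())))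

    ⇒-translation-first-child : ∀ {p} → LtEq 𝕄 w p (suc p) →
                                Sat ⇒-translation (suc p) ⇔ SiblingUntilVia⋖⊎≐ p (suc p)
    ⇒-translation-first-child {p} p≤1+p = mk⇔ to from
      where
        not-right-context : ∀ {h} → ¬ Ch h (suc p)
        not-right-context c = LtEq⇒¬⋗ p≤1+p (chain-last-⋗ c)

        to : Sat ⇒-translation (suc p) → SiblingUntilVia⋖⊎≐ p (suc p)
        to (inj₁ (_ , _ , _ , (_ , c) , _)) = ⊥-elim (not-right-context c)
        to (inj₂ (inj₁ (_ , _ , _ , (_ , c) , _))) = ⊥-elim (not-right-context c)
        to (inj₂ (inj₂ (inj₁ d₃@(p⋖1+p , _)))) = inj₁ (Equivalence.to (D₃⇔SiblingUntilVia⋖ p⋖1+p) d₃)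
        to (inj₂ (inj₂ (inj₂ d₄@(p⋖1+p , _)))) = inj₂ (Equivalence.to (D₄⇔SiblingUntilVia≐ p⋖1+p) d₄)

        from : SiblingUntilVia⋖⊎≐ p (suc p) → Sat ⇒-translation (suc p)
        from (inj₁ s@(_ , (_ , c) , _)) =
          inj₂ (inj₂ (inj₁ (Equivalence.from (D₃⇔SiblingUntilVia⋖ (prec (chain-first-⋖ c))) s)))
        from (inj₂ s@(_ , (_ , c) , _)) =
          inj₂ (inj₂ (inj₂ (Equivalence.from (D₄⇔SiblingUntilVia≐ (prec (chain-first-⋖ c))) s)))

    ⇒-translation-χ-child : ∀ {p i} → ChildCond 𝕄 w p i → Sat ⇒-translation i ⇔ SiblingUntilVia⋖⊎≐ p i
    ⇒-translation-χ-child {p} {i} (χi@(_ , ci) , inj₁ p⋖i) = mk⇔ to from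
      where
        to : Sat ⇒-translation i → SiblingUntilVia⋖⊎≐ p i
        to (inj₁ d₁) = inj₁ (Equivalence.to (nextUH-untilUH⇔SiblingUntilVia⋖ χi p⋖i) d₁)
        to (inj₂ (inj₁ d₂)) = inj₂ (Equivalence.to (D₂⇔SiblingUntilVia≐ χi p⋖i) d₂)
        to (inj₂ (inj₂ (inj₁ d₃))) = ⊥-elim (prevLt-at-right-context ci d₃)
        to (inj₂ (inj₂ (inj₂ d₄))) = ⊥-elim (prevLt-at-right-context ci d₄)

        from : SiblingUntilVia⋖⊎≐ p i → Sat ⇒-translation i
        from (inj₁ s) = inj₁ (Equivalence.from (nextUH-untilUH⇔SiblingUntilVia⋖ χi p⋖i) s)
        from (inj₂ s) = inj₂ (inj₁ (Equivalence.from (D₂⇔SiblingUntilVia≐ χi p⋖i) s))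
    ⇒-translation-χ-child {p} {i} ((_ , ci) , inj₂ p≐i) = mk⇔ to from
      where
        not-⋖-right-context : ∀ {h} → Ch h i → ¬ h ⋖ʷ i
        not-⋖-right-context c h⋖i with LtEq-parent-unique c (inj₁ h⋖i) ci (inj₂ p≐i)
        ... | refl = ⋖⇒¬≐ {p} {i} (pr h⋖i) (pr p≐i)

        to : Sat ⇒-translation i → SiblingUntilVia⋖⊎≐ p i
        to (inj₁ (_ , _ , _ , (_ , c) , h⋖i , _)) = ⊥-elim (not-⋖-right-context c h⋖i)
        to (inj₂ (inj₁ (_ , _ , _ , (_ , c) , h⋖i , _))) = ⊥-elim (not-⋖-right-context c h⋖i)
        to (inj₂ (inj₂ (inj₁ d₃))) = ⊥-elim (prevLt-at-right-context ci d₃)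
        to (inj₂ (inj₂ (inj₂ d₄))) = ⊥-elim (prevLt-at-right-context ci d₄)

        later-sibling-impossible : ∀ {t} → χʷ p t → i < t → ⊥
        later-sibling-impossible (_ , ct) i<t = ⋖⇒¬≐ (shared-left-⋖ ci ct i<t) (pr p≐i)

        from : SiblingUntilVia⋖⊎≐ p i → Sat ⇒-translation i
        from (inj₁ (_ , χt , _ , i<t , _)) = ⊥-elim (later-sibling-impossible χt i<t)
        from (inj₂ (_ , χt , _ , i<t , _)) = ⊥-elim (later-sibling-impossible χt i<t)

    ⇒-translation⇔SiblingUntil : ∀ {p i x} → ChildAt p i x → Sat ⇒-translation i ⇔ SiblingUntil Φ Ψ p i
    ⇒-translation⇔SiblingUntil (inj₁ (_ , refl , p≤1+p)) =
      ⇔-sym SiblingUntil-split ⇔-∘ ⇒-translation-first-child p≤1+p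
    ⇒-translation⇔SiblingUntil (inj₂ (_ , cc)) = ⇔-sym SiblingUntil-split ⇔-∘ ⇒-translation-χ-child cc

open OPWord

lemma4p7 : ∀ {k : ℕ} (𝕄 : OPM k) {n : ℕ} (w : Vec (Subset k) n) →
    Compatible 𝕄 w →
    (φ ψ : XF k) →
    (∀ i′ s′ → Tau 𝕄 w i′ s′ → XSat 𝕄 w s′ φ ⇔ PSat 𝕄 w i′ (ι φ)) →
    (∀ i′ s′ → Tau 𝕄 w i′ s′ → XSat 𝕄 w s′ ψ ⇔ PSat 𝕄 w i′ (ι ψ)) →
    ∀ i s → Tau 𝕄 w i s →
    XSat 𝕄 w s (until ⇒ φ ψ) ⇔ PSat 𝕄 w i (ι (until ⇒ φ ψ))
lemma4p7 𝕄 w _ φ ψ hφ hψ _ _ τi with Tau-root-or-child 𝕄 w τi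
... | inj₁ (refl , refl) = mk⇔ (⊥-elim ∘ XSat-⇒-root 𝕄 w) (⊥-elim ∘ ⇒-translation-root 𝕄 w (ι φ) (ι ψ))
... | inj₂ (_ , _ , refl , _ , τp , child) =
  ⇔-sym (⇒-translation⇔SiblingUntil 𝕄 w (ι φ) (ι ψ) child)
    ⇔-∘ XSat-⇒⇔SiblingUntil 𝕄 w φ ψ _ _ hφ hψ τp τi child
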